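{- Let $n\ge1$ and let $K^0_n$ be the complete graph on vertex set $[n]\cup\{0\}$ with sink $0$. Then $\mathrm{PPF}_n=\mathrm{PPF}(K^0_n)$, where functions $[n]\to\mathbb N$ are identified with tuples $(p_1,\dots,p_n)$. In particular, $|\mathrm{PPF}(K^0_n)|=|\mathrm{SR}(K^0_n)|=(n-1)^{n-1}$.
   Context: $\mathbb N=\{1,2,\dots\}$. A (classical) parking function of size $n$ is $p=(p_1,\dots,p_n)\in[n]^n$ such that $|\{j:p_j\le i\}|\ge i$ for all $i\in[n]$; $\mathrm{PF}_n$ is their set. $p\in\mathrm{PF}_n$ has a breakpoint at $j\in[n]$ if $|\{i\in[n]:p_i\le j\}|=j$; $p$ is prime if its only breakpoint is $j=n$; $\mathrm{PPF}_n$ is the set of prime parking functions of size $n$. For a graph $G$ (finite connected multigraph, no loops) with vertex set $V$, sink $s$, $\tilde V=V\setminus\{s\}$: $\mathrm{mult}(vw)$ is the number of edges between $v,w$; $\deg^A(v)=\sum_{w\in A}\mathrm{mult}(vw)$, $\deg(v)=\deg^V(v)$. A $G$-parking function is $p:\tilde V\to\mathbb N$ such that every non-empty $S\subseteq\tilde V$ contains $v$ with $p(v)\le\deg^{V\setminus S}(v)$. For $A\subseteq\tilde V$, $G^A$ is the induced subgraph on $A\cup\{s\}$ with sink $s$ (parking functions defined likewise). $p$ is decomposable w.r.t. an ordered partition $(A,B)$ of $\tilde V$ ($A,B\ne\emptyset$) if $p|_A$ is a $G^A$-parking function and $v\mapsto p(v)-\deg^A(v)$ on $B$ is a $G^B$-parking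 function; $p$ is prime if decomposable w.r.t. no such partition; $\mathrm{PPF}(G)$ is the set of prime $G$-parking functions. Sandpile configurations are $c:\tilde V\to\mathbb Z$; stable if $c(v)<\deg(v)$; a stable $c$ is recurrent if it is a recurrent state of the Abelian sandpile Markov chain, equivalently there is an ordering $v_1,\dots$ of $\tilde V$ with $c(v_i)\ge\deg^{V\setminus\{s,v_1,\dots,v_{i-1}\}}(v_i)$ for all $i$. For recurrent $c$, $V_M(c)=\{v\in\tilde V:\mathrm{mult}(vs)\ge1,\ c(v)\ge\deg(v)-\mathrm{mult}(vs)\}$ and $c^{v- }=c-\sum_{w\in\tilde V\setminus\{v\}}\mathrm{mult}(ws)\mathbb 1_w$; $c$ is strongly recurrent if $c^{v- }$ is recurrent for all $v\in V_M(c)$; $\mathrm{SR}(G)$ is their set. -}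

module Defs where

open import Data.Nat using (ℕ; zero; suc; _≤_; _<_; _≤?_; _∸_; _+_; _<ᵇ_)
open import Data.Integer as ℤ using (ℤ; +_)
open import Data.Fin using (Fin; toℕ) renaming (_≟_ to _≟ᶠ_)
open import Data.Fin.Subset using (Subset; _∈_; _⊆_; ∁; _─_; _∪_; ⁅_⁆; ⊥; ⊤; Nonempty)
open import Data.Vec using (Vec; lookup; tabulate; sum; count; foldr; allFin)
open import Data.Bool using (Bool; true; false; if_then_else_)
open import Data.Product using (_×_; ∃; ∃-syntax)
open import Data.List using (List; length)
open import Data.List.Membership.Propositional as L using ()
open import Data.List.Relation.Unary.Unique.Propositional using (Unique)
open import Relation.Nullary using (¬_; does)
open import Relation.Binary.PropositionalEquality using (_≡_)
open import Function.Definitions using (Injective)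
open import Function.Bundles using (_⇔_)

HasCard : {A : Set} → (A → Set) → ℕ → Set
HasCard {A} P m =
  ∃[ xs ] (Unique xs × (∀ (x : A) → (x L.∈ xs) ⇔ P x) × length xs ≡ m)

countLe : ∀ {n} → Vec ℕ n → ℕ → ℕ
countLe p j = count (_≤? j) p

IsPF : (n : ℕ) → Vec ℕ n → Set
IsPF n p = (∀ i → 1 ≤ lookup p i × lookup p i ≤ n)
         × (∀ j → 1 ≤ j → j ≤ n → j ≤ countLe p j)

Breakpoint : (n : ℕ) → Vec ℕ n → ℕ → Set
Breakpoint n p j = 1 ≤ j × j ≤ n × countLe p j ≡ j

IsPrimePF : (n : ℕ) → Vec ℕ n → Set
IsPrimePF n p = IsPF n p × (∀ j → Breakpoint n p j → j ≡ n)

-- The non-sink vertices Ṽ are Fin n; the sink s is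
-- a separate vertex.  sinkMult v = mult(vs), mult v w = mult(vw) for v,w ∈ Ṽ.
-- (Standing assumptions: symmetric, loopless, connected.)

record Graph : Set where
  field
    n        : ℕ
    sinkMult : Fin n → ℕ
    mult     : Fin n → Fin n → ℕ
open Graph public

degIn : (G : Graph) → Subset (n G) → Fin (n G) → ℕ
degIn G A v = sum (tabulate λ w → if lookup A w then mult G v w else 0)

deg : (G : Graph) → Fin (n G) → ℕ
deg G v = sinkMult G v + degIn G ⊤ v

-- p|_A is a G^A-parking function (G^A = induced subgraph on A ∪ {s}).
-- Values in ℕ = {1,2,…}; deg^{(A∪{s}) ∖ S}(v) = mult(vs) + deg^{A∖S}(v).
IsPFOn : (G : Graph) → Subset (n G) → Vec ℕ (n G) → Set
IsPFOn G A p =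
  (∀ v → v ∈ A → 1 ≤ lookup p v) ×
  (∀ (S : Subset (n G)) → Nonempty S → S ⊆ A →
     ∃[ v ] (v ∈ S × lookup p v ≤ sinkMult G v + degIn G (A ─ S) v))

IsGPF : (G : Graph) → Vec ℕ (n G) → Set
IsGPF G p = IsPFOn G ⊤ p

-- The shifted function v ↦ p(v) - deg^A(v) must take values in ℕ = {1,2,…};
-- using truncated subtraction, a non-positive value becomes 0 and is
-- rejected by the positivity clause of IsPFOn.
Decomposable : (G : Graph) → Subset (n G) → Vec ℕ (n G) → Set
Decomposable G A p =
  Nonempty A × Nonempty (∁ A) ×
  IsPFOn G A p ×
  IsPFOn G (∁ A) (tabulate λ v → lookup p v ∸ degIn G A v)

IsPrimeGPF : (G : Graph) → Vec ℕ (n G) → Set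
IsPrimeGPF G p = IsGPF G p × (∀ A → ¬ Decomposable G A p)

Stable : (G : Graph) → Vec ℤ (n G) → Set
Stable G c = ∀ v → lookup c v ℤ.< + deg G v

-- {σ 0, …, σ (i-1)}
prefix : ∀ {m} → (Fin m → Fin m) → Fin m → Subset m
prefix {m} σ i =
  foldr _ (λ j acc → if toℕ j <ᵇ toℕ i then ⁅ σ j ⁆ ∪ acc else acc) ⊥ (allFin m)

Recurrent : (G : Graph) → Vec ℤ (n G) → Set
Recurrent G c = Stable G c ×
  ∃[ σ ] (Injective _≡_ _≡_ σ ×
          (∀ i → + degIn G (∁ (prefix σ i)) (σ i) ℤ.≤ lookup c (σ i)))

InVM : (G : Graph) → Vec ℤ (n G) → Fin (n G) → Set
InVM G c v = 1 ≤ sinkMult G v × (+ deg G v ℤ.- + sinkMult G v) ℤ.≤ lookup c v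

minusAt : (G : Graph) → Vec ℤ (n G) → Fin (n G) → Vec ℤ (n G)
minusAt G c v = tabulate λ w →
  if does (w ≟ᶠ v) then lookup c w else lookup c w ℤ.- + sinkMult G w

StronglyRecurrent : (G : Graph) → Vec ℤ (n G) → Set
StronglyRecurrent G c =
  Recurrent G c × (∀ v → InVM G c v → Recurrent G (minusAt G c v))

-- K⁰ₙ : complete graph on [n] ∪ {0}, sink 0; non-sink vertex i ∈ [n]
-- is represented by the Fin n element of index i-1.

K0 : ℕ → Graph
K0 m = record
  { n        = m
  ; sinkMult = λ _ → 1
  ; mult     = λ v w → if does (v ≟ᶠ w) then 0 else 1
  }

-- In K⁰ₙ the degree deg^A(v) is |A| or |A| − 1 according as v ∉ A or v ∈ A, so a
-- K⁰ₙ^A-parking function is just a classical parking function on the vertices of A, and a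
-- decomposition along (A, B) exists exactly when |A| < n is a breakpoint (A being the
-- vertices of value ≤ |A|); hence the two notions of primality agree.
-- The configuration c = n − p is recurrent iff p is a parking function (Dhar's burning
-- order: list the vertices by increasing p; the i-th one needs p ≤ i).  For v ∈ V_M(c),
-- i.e. p v = 1, the configuration c^{v-} corresponds to raising p by one off v, which is a
-- parking function iff p parks strictly below n, i.e. iff p is prime.
-- Finally, for a ∈ [1,m]^{m+1} and F t = #{i : a_i ≤ t}, exactly one of the m cyclic
-- shifts x ↦ x − u (mod m, values in [1,m]) of a is a prime parking function, namely the
-- one at the last minimum u ∈ [0,m) of F t − t.  Fixing a's first entry to m therefore
-- gives a bijection [1,m]^m ≅ PPF_{m+1}, and c = n − p transports it to SR(K⁰ₙ).

module Submission where

open import Defs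
open import Data.Bool using (Bool; true; false; if_then_else_; not; _∧_; _∨_; T)
import Data.Bool.Properties as Bool
open import Data.Empty using (⊥-elim)
open import Data.Fin using (Fin; zero; suc; toℕ; fromℕ<; punchOut) renaming (_≟_ to _≟ᶠ_)
open import Data.Fin.Properties using (any?; toℕ<n; toℕ-fromℕ<; toℕ-injective; injective⇒≤; punchOut-injective)
open import Data.Fin.Subset using (Subset; _∈_; _⊆_; ∁; _─_; _∪_; ⁅_⁆; ⊤; ⊥; Nonempty)
open import Data.Fin.Subset.Properties using (nonempty?; ∈⊤)
open import Data.Integer as ℤ using (ℤ; +_; -[1+_])
import Data.Integer.Properties as ℤ
import Data.Integer.Tactic.RingSolver as ℤ-Solver
open import Data.List as List using (List; []; _∷_; length; cartesianProductWith; applyUpTo)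
open import Data.List.Properties using (length-map; length-++; length-applyUpTo)
open import Data.List.Membership.Propositional using () renaming (_∈_ to _∈ₗ_)
open import Data.List.Membership.Propositional.Properties
  using (∈-map⁺; ∈-map⁻; ∈-cartesianProductWith⁺; ∈-cartesianProductWith⁻; ∈-applyUpTo⁺; ∈-applyUpTo⁻)
import Data.List.Relation.Unary.All as ListAll
import Data.List.Relation.Unary.All.Properties as ListAll
open import Data.List.Relation.Unary.AllPairs using ([]; _∷_)
open import Data.List.Relation.Unary.Any using (here; there)
open import Data.List.Relation.Unary.Unique.Propositional using (Unique)
open import Data.List.Relation.Unary.Unique.Propositional.Properties using (cartesianProductWith⁺; applyUpTo⁺₁)
open import Data.Nat as ℕ
  using (ℕ; zero; suc; _+_; _*_; _∸_; _^_; _≤_; _<_; _≤ᵇ_; _<ᵇ_; _≤?_; _<?_; z≤n; s≤s; s≤s⁻¹; >-nonZero)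
open import Data.Nat.Properties
import Data.Nat.Tactic.RingSolver as ℕ-Solver
open import Data.Product using (_×_; _,_; proj₁; proj₂; ∃-syntax)
open import Data.Vec as Vec using (Vec; []; _∷_; lookup; tabulate; map; foldr; allFin)
open import Data.Vec.Membership.Propositional using () renaming (_∈_ to _∈ᵥ_)
open import Data.Vec.Membership.Propositional.Properties using (∈-allFin⁺)
open import Data.Vec.Properties
  using ([]=⇒lookup; lookup⇒[]=; lookup-map; lookup-zipWith; lookup-replicate; lookup∘tabulate;
         tabulate-cong; tabulate∘lookup; ∷-injective; ∷-injectiveˡ; ∷-injectiveʳ)
open import Data.Vec.Relation.Unary.All as All using (All; []; _∷_)
import Data.Vec.Relation.Unary.All.Properties as All
open import Data.Vec.Relation.Unary.Any using (here; there)
open import Function using (_∘_)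
open import Function.Bundles using (_⇔_; mk⇔; Equivalence)
open import Function.Definitions using (Injective)
open import Relation.Binary.Definitions using (tri<; tri≈; tri>)
open import Relation.Binary.PropositionalEquality
  using (_≡_; refl; sym; trans; cong; cong₂; subst; subst₂; module ≡-Reasoning)
open import Relation.Nullary using (¬_; does; yes; no; contradiction)
open import Relation.Nullary.Decidable using (dec-true; dec-false; _×-dec_)

open import Algebra.Properties.AbelianGroup ℤ.+-0-abelianGroup using () renaming (∙-cancelˡ to +-cancelˡ)
open import Algebra.Properties.CommutativeMonoid.Sum +-0-commutativeMonoid
  using (sum-cong-≗; ∑-distrib-+; ∑-comm; sum-replicate-zero)
  renaming (sum to ∑)

-- Finite sums and counting over Fin n

χ : Bool → ℕ
χ true  = 1
χ false = 0

χ≤1 : ∀ b → χ b ≤ 1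
χ≤1 true  = ≤-refl
χ≤1 false = z≤n

∑-tabulate : ∀ {n} (f : Fin n → ℕ) → Vec.sum (tabulate f) ≡ ∑ f
∑-tabulate {zero}  f = refl
∑-tabulate {suc n} f = cong (_+_ (f zero)) (∑-tabulate (f ∘ suc))

∑-zeros : ∀ n → ∑ {n} (λ _ → 0) ≡ 0
∑-zeros = sum-replicate-zero

∑-ones : ∀ n → ∑ {n} (λ _ → 1) ≡ n
∑-ones zero    = refl
∑-ones (suc n) = cong suc (∑-ones n)

∑-mono-≤ : ∀ {n} {f g : Fin n → ℕ} → (∀ i → f i ≤ g i) → ∑ f ≤ ∑ g
∑-mono-≤ {zero}  f≤g = z≤n
∑-mono-≤ {suc n} f≤g = +-mono-≤ (f≤g zero) (∑-mono-≤ (f≤g ∘ suc))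

∑-mono-< : ∀ {n} {f g : Fin n → ℕ} → (∀ i → f i ≤ g i) → ∀ k → f k < g k → ∑ f < ∑ g
∑-mono-< f≤g zero    fk<gk = +-mono-<-≤ fk<gk (∑-mono-≤ (f≤g ∘ suc))
∑-mono-< f≤g (suc k) fk<gk = +-mono-≤-< (f≤g zero) (∑-mono-< (f≤g ∘ suc) k fk<gk)

term≤∑ : ∀ {n} (f : Fin n → ℕ) k → f k ≤ ∑ f
term≤∑ f zero    = m≤m+n (f zero) _
term≤∑ f (suc k) = ≤-trans (term≤∑ (f ∘ suc) k) (m≤n+m _ (f zero))

∑-select : ∀ {n} (v : Fin n) (g : Fin n → ℕ) → ∑ (λ w → if does (v ≟ᶠ w) then g w else 0) ≡ g v
∑-select {suc n} zero    g = trans (cong (_+_ (g zero)) (∑-zeros n)) (+-identityʳ (g zero))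
∑-select {suc n} (suc v) g = ∑-select v (g ∘ suc)

# : ∀ {n} → (Fin n → Bool) → ℕ
# b = ∑ (χ ∘ b)

#≤n : ∀ {n} (b : Fin n → Bool) → # b ≤ n
#≤n {n} b = subst (# b ≤_) (∑-ones n) (∑-mono-≤ (χ≤1 ∘ b))

#<n : ∀ {n} (b : Fin n → Bool) k → b k ≡ false → # b < n
#<n {n} b k bk = subst (# b <_) (∑-ones n) (∑-mono-< (χ≤1 ∘ b) k (subst (λ x → χ x < 1) (sym bk) ≤-refl))

#-pos⇒true : ∀ {n} (b : Fin n → Bool) → 1 ≤ # b → ∃[ k ] b k ≡ true
#-pos⇒true {suc n} b pos with b zero in e
... | true  = zero , e
... | false = let (k , bk) = #-pos⇒true (b ∘ suc) pos in suc k , bk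

#<n⇒false : ∀ {n} (b : Fin n → Bool) → # b < n → ∃[ k ] b k ≡ false
#<n⇒false {suc n} b lt with b zero in e
... | false = zero , e
... | true  = let (k , bk) = #<n⇒false (b ∘ suc) (≤-pred lt) in suc k , bk

#≥n⇒true : ∀ {n} (b : Fin n → Bool) → n ≤ # b → ∀ k → b k ≡ true
#≥n⇒true b n≤ k with b k in e
... | true  = refl
... | false = ⊥-elim (<⇒≱ (#<n b k e) n≤)

≤ᵇ-true : ∀ {a b} → a ≤ b → (a ≤ᵇ b) ≡ true
≤ᵇ-true {a} {b} = dec-true (a ≤? b)

≤ᵇ-false : ∀ {a b} → b < a → (a ≤ᵇ b) ≡ false
≤ᵇ-false {a} {b} b<a = dec-false (a ≤? b) (<⇒≱ b<a)

≤ᵇ-true⁻¹ : ∀ {a b} → (a ≤ᵇ b) ≡ true → a ≤ b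
≤ᵇ-true⁻¹ {a} {b} e = ≤ᵇ⇒≤ a b (Equivalence.from Bool.T-≡ e)

≤ᵇ-false⁻¹ : ∀ {a b} → (a ≤ᵇ b) ≡ false → b < a
≤ᵇ-false⁻¹ e = ≰⇒> (λ a≤b → subst T e (≤⇒≤ᵇ a≤b))

≤ᵇ-suc : ∀ a b → (suc a ≤ᵇ suc b) ≡ (a ≤ᵇ b)
≤ᵇ-suc zero    b = refl
≤ᵇ-suc (suc a) b = refl

∸-≤ᵇ : ∀ x j k → (x ∸ j ≤ᵇ k) ≡ (x ≤ᵇ j + k)
∸-≤ᵇ x       zero    k = refl
∸-≤ᵇ zero    (suc j) k = refl
∸-≤ᵇ (suc x) (suc j) k = trans (∸-≤ᵇ x j k) (sym (≤ᵇ-suc x (j + k)))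

≤ᵇ-+ʳ : ∀ x y d → (x + d ≤ᵇ y + d) ≡ (x ≤ᵇ y)
≤ᵇ-+ʳ x y zero    rewrite +-identityʳ x | +-identityʳ y = refl
≤ᵇ-+ʳ x y (suc d) rewrite +-suc x d | +-suc y d = trans (≤ᵇ-suc (x + d) (y + d)) (≤ᵇ-+ʳ x y d)

-- Subsets of the non-sink vertices and degrees in K⁰ₙ

card : ∀ {n} → Subset n → ℕ
card A = # (lookup A)

lookup-⁅⁆ : ∀ {n} (v w : Fin n) → lookup ⁅ v ⁆ w ≡ does (v ≟ᶠ w)
lookup-⁅⁆ zero    zero    = refl
lookup-⁅⁆ zero    (suc w) = lookup-replicate w false
lookup-⁅⁆ (suc v) zero    = refl
lookup-⁅⁆ (suc v) (suc w) with v ≟ᶠ w | lookup-⁅⁆ v w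
... | yes _ | e = e
... | no _  | e = e

module _ {n : ℕ} where

  ∈⇒lookup : ∀ {A : Subset n} {v} → v ∈ A → lookup A v ≡ true
  ∈⇒lookup = []=⇒lookup

  lookup⇒∈ : ∀ {A : Subset n} {v} → lookup A v ≡ true → v ∈ A
  lookup⇒∈ {A} {v} = lookup⇒[]= v A

  lookup-⊤ : ∀ (v : Fin n) → lookup ⊤ v ≡ true
  lookup-⊤ v = lookup-replicate v true

  lookup-∁ : ∀ (A : Subset n) v → lookup (∁ A) v ≡ not (lookup A v)
  lookup-∁ A v = lookup-map v not A

  lookup-─ : ∀ (A S : Subset n) v → lookup (A ─ S) v ≡ lookup A v ∧ not (lookup S v)
  lookup-─ A S v with lookup S v | lookup-zipWith _ v A S
  ... | true  | e = trans e (sym (Bool.∧-zeroʳ _))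
  ... | false | e = trans e (sym (Bool.∧-identityʳ _))

  lookup-─-∈ : ∀ {A S : Subset n} {w} → w ∈ S → lookup (A ─ S) w ≡ false
  lookup-─-∈ {A} {S} {w} w∈S rewrite lookup-─ A S w | ∈⇒lookup w∈S = Bool.∧-zeroʳ _

  ∈∁⇒lookup : ∀ {A : Subset n} {w} → w ∈ ∁ A → lookup A w ≡ false
  ∈∁⇒lookup {A} {w} w∈∁A with lookup A w | trans (sym (lookup-∁ A w)) (∈⇒lookup w∈∁A)
  ... | false | _ = refl

  lookup⇒∈∁ : ∀ {A : Subset n} {w} → lookup A w ≡ false → w ∈ ∁ A
  lookup⇒∈∁ {A} {w} w∉A = lookup⇒∈ (trans (lookup-∁ A w) (cong not w∉A))

  card-⊤ : card (⊤ {n}) ≡ n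
  card-⊤ = trans (sum-cong-≗ (cong χ ∘ lookup-⊤)) (∑-ones n)

  card-∁ : ∀ (A : Subset n) → card A + card (∁ A) ≡ n
  card-∁ A = trans (sym (∑-distrib-+ (χ ∘ lookup A) (χ ∘ lookup (∁ A)))) (trans (sum-cong-≗ χ+χ∁) (∑-ones n))
    where
    χ+χ∁ : ∀ w → χ (lookup A w) + χ (lookup (∁ A) w) ≡ 1
    χ+χ∁ w rewrite lookup-∁ A w with lookup A w
    ... | true  = refl
    ... | false = refl

  card-─ : ∀ {A S : Subset n} → S ⊆ A → card (A ─ S) + card S ≡ card A
  card-─ {A} {S} S⊆A = trans (sym (∑-distrib-+ (χ ∘ lookup (A ─ S)) (χ ∘ lookup S))) (sum-cong-≗ split)
    where
    split : ∀ w → χ (lookup (A ─ S) w) + χ (lookup S w) ≡ χ (lookup A w)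
    split w rewrite lookup-─ A S w with lookup S w in w∈S
    ... | true  rewrite ∈⇒lookup (S⊆A (lookup⇒∈ w∈S)) = refl
    ... | false = trans (+-identityʳ _) (cong χ (Bool.∧-identityʳ _))

  nonempty⇒card≥1 : ∀ {S : Subset n} → Nonempty S → 1 ≤ card S
  nonempty⇒card≥1 {S} (v , v∈S) =
    subst (_≤ card S) (cong χ (∈⇒lookup v∈S)) (term≤∑ (χ ∘ lookup S) v)

  card-empty : ∀ {S : Subset n} → ¬ Nonempty S → card S ≡ 0
  card-empty {S} empty = trans (sum-cong-≗ outside) (∑-zeros n)
    where
    outside : ∀ w → χ (lookup S w) ≡ 0
    outside w with lookup S w in w∈S
    ... | true  = ⊥-elim (empty (w , lookup⇒∈ w∈S))
    ... | false = refl

  degIn-K0 : ∀ (A : Subset n) v → degIn (K0 n) A v + χ (lookup A v) ≡ card A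
  degIn-K0 A v = begin
      degIn (K0 n) A v + χ (lookup A v)
    ≡⟨ cong₂ _+_ (∑-tabulate others) (sym (∑-select v (χ ∘ lookup A))) ⟩
      ∑ others + ∑ self
    ≡⟨ sym (∑-distrib-+ others self) ⟩
      ∑ (λ w → others w + self w)
    ≡⟨ sum-cong-≗ others+self ⟩
      card A ∎
    where
    open ≡-Reasoning
    others self : Fin n → ℕ
    others w = if lookup A w then (if does (v ≟ᶠ w) then 0 else 1) else 0
    self   w = if does (v ≟ᶠ w) then χ (lookup A w) else 0
    others+self : ∀ w → others w + self w ≡ χ (lookup A w)
    others+self w with lookup A w | does (v ≟ᶠ w)
    ... | true  | true  = refl
    ... | true  | false = refl
    ... | false | true  = refl
    ... | false | false = refl

  degIn-K0-∉ : ∀ (A : Subset n) v → lookup A v ≡ false → degIn (K0 n) A v ≡ card A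
  degIn-K0-∉ A v v∉A = trans (sym (+-identityʳ _)) (subst (λ b → degIn (K0 n) A v + χ b ≡ card A) v∉A (degIn-K0 A v))

  degIn-K0-∈ : ∀ (A : Subset n) v → lookup A v ≡ true → suc (degIn (K0 n) A v) ≡ card A
  degIn-K0-∈ A v v∈A = trans (+-comm 1 _) (subst (λ b → degIn (K0 n) A v + χ b ≡ card A) v∈A (degIn-K0 A v))

  deg-K0 : ∀ (v : Fin n) → deg (K0 n) v ≡ n
  deg-K0 v = trans (degIn-K0-∈ ⊤ v (lookup-⊤ v)) card-⊤

-- Parking functions on K⁰ₙ

countLe-∑ : ∀ {n} (p : Vec ℕ n) j → countLe p j ≡ # (λ i → lookup p i ≤ᵇ j)
countLe-∑ []      j = refl
countLe-∑ (x ∷ p) j with x ≤ᵇ j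
... | true  = cong suc (countLe-∑ p j)
... | false = countLe-∑ p j

countOn : ∀ {n} → Subset n → Vec ℕ n → ℕ → ℕ
countOn A q k = # (λ w → lookup A w ∧ (lookup q w ≤ᵇ k))

IsClassicalPFOn : ∀ {n} → Subset n → Vec ℕ n → Set
IsClassicalPFOn A q = (∀ v → v ∈ A → 1 ≤ lookup q v)
                    × (∀ k → 1 ≤ k → k ≤ card A → k ≤ countOn A q k)

module _ {n : ℕ} where

  countOn-⊤ : ∀ (p : Vec ℕ n) k → countOn ⊤ p k ≡ countLe p k
  countOn-⊤ p k = trans (sum-cong-≗ (λ w → cong (λ b → χ (b ∧ (lookup p w ≤ᵇ k))) (lookup-⊤ w)))
                        (sym (countLe-∑ p k))

  countOn<card : ∀ (A : Subset n) q {k v} → lookup A v ≡ true → k < lookup q v → countOn A q k < card A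
  countOn<card A q {k} {v} v∈A k<qv = ∑-mono-< (λ w → χ-∧≤ (lookup A w) _) v strict
    where
    χ-∧≤ : ∀ a b → χ (a ∧ b) ≤ χ a
    χ-∧≤ true  b = χ≤1 b
    χ-∧≤ false b = z≤n
    strict : χ (lookup A v ∧ (lookup q v ≤ᵇ k)) < χ (lookup A v)
    strict rewrite v∈A | ≤ᵇ-false k<qv = ≤-refl

  above : Subset n → Vec ℕ n → ℕ → Subset n
  above A q k = tabulate λ w → lookup A w ∧ not (lookup q w ≤ᵇ k)

  card-─above : ∀ A q k → card (A ─ above A q k) ≡ countOn A q k
  card-─above A q k = sum-cong-≗ pointwise
    where
    pointwise : ∀ w → χ (lookup (A ─ above A q k) w) ≡ χ (lookup A w ∧ (lookup q w ≤ᵇ k))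
    pointwise w rewrite lookup-─ A (above A q k) w | lookup∘tabulate (λ w → lookup A w ∧ not (lookup q w ≤ᵇ k)) w
      with lookup A w | lookup q w ≤ᵇ k
    ... | true  | true  = refl
    ... | true  | false = refl
    ... | false | _     = refl

  above⊆ : ∀ {A q k} → above A q k ⊆ A
  above⊆ {A} {q} {k} {w} w∈ =
    lookup⇒∈ (∧-true-left (trans (sym (lookup∘tabulate _ w)) (∈⇒lookup w∈)))
    where ∧-true-left : ∀ {a b} → a ∧ b ≡ true → a ≡ true
          ∧-true-left {true} _ = refl

  above⇒> : ∀ {A q k w} → w ∈ above A q k → k < lookup q w
  above⇒> {A} {q} {k} {w} w∈ =
    ≤ᵇ-false⁻¹ (not-true (∧-true-right (trans (sym (lookup∘tabulate _ w)) (∈⇒lookup w∈))))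
    where ∧-true-right : ∀ {a b} → a ∧ b ≡ true → b ≡ true
          ∧-true-right {true} e = e
          not-true : ∀ {b} → not b ≡ true → b ≡ false
          not-true {false} _ = refl

  isPFOn⇒classical : ∀ A q → IsPFOn (K0 n) A q → IsClassicalPFOn A q
  isPFOn⇒classical A q (pos , parks) = pos , counts
    where
    counts : ∀ k → 1 ≤ k → k ≤ card A → k ≤ countOn A q k
    counts k _ k≤|A| with nonempty? (above A q k)
    ... | no empty = subst (k ≤_) all-counted k≤|A|
      where
      all-counted : card A ≡ countOn A q k
      all-counted = begin
        card A                                   ≡⟨ card-─ (above⊆ {A} {q} {k}) ⟨
        card (A ─ above A q k) + card (above A q k) ≡⟨ cong (_+_ (card (A ─ above A q k))) (card-empty empty) ⟩
        card (A ─ above A q k) + 0               ≡⟨ +-identityʳ _ ⟩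
        card (A ─ above A q k)                   ≡⟨ card-─above A q k ⟩
        countOn A q k                            ∎
        where open ≡-Reasoning
    ... | yes S≠∅ with parks (above A q k) S≠∅ (above⊆ {A} {q} {k})
    ...   | w , w∈S , qw≤ = s≤s⁻¹ (begin-strict
      k                                    <⟨ above⇒> {A} {q} {k} w∈S ⟩
      lookup q w                           ≤⟨ qw≤ ⟩
      suc (degIn (K0 n) (A ─ above A q k) w)
        ≡⟨ cong suc (degIn-K0-∉ (A ─ above A q k) w (lookup-─-∈ {A = A} w∈S)) ⟩
      suc (card (A ─ above A q k))         ≡⟨ cong suc (card-─above A q k) ⟩
      suc (countOn A q k)                  ∎)
      where open ≤-Reasoning

  classical⇒isPFOn : ∀ A q → IsClassicalPFOn A q → IsPFOn (K0 n) A q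
  classical⇒isPFOn A q (pos , counts) = pos , parks
    where
    parks : ∀ S → Nonempty S → S ⊆ A → ∃[ v ] (v ∈ S × lookup q v ≤ suc (degIn (K0 n) (A ─ S) v))
    parks S S≠∅ S⊆A with any? (λ v → (lookup S v Bool.≟ true) ×-dec (lookup q v ≤? suc (degIn (K0 n) (A ─ S) v)))
    ... | yes (v , v∈S , ok) = v , lookup⇒∈ v∈S , ok
    -- If no vertex of S parks, all of S lies above k = |A ─ S| + 1, so at most k − 1 values are ≤ k.
    ... | no none = ⊥-elim (<⇒≱ (s≤s (∑-mono-≤ counted⇒outside)) (counts k (s≤s z≤n) k≤|A|))
      where
      k = suc (card (A ─ S))
      k≤|A| : k ≤ card A
      k≤|A| = subst (k ≤_) (card-─ S⊆A) (subst (_≤ card (A ─ S) + card S) (+-comm (card (A ─ S)) 1)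
                (+-monoʳ-≤ (card (A ─ S)) (nonempty⇒card≥1 S≠∅)))
      S-above : ∀ w → lookup S w ≡ true → k < lookup q w
      S-above w w∈S with lookup q w ≤? suc (degIn (K0 n) (A ─ S) w)
      ... | yes ok  = ⊥-elim (none (w , w∈S , ok))
      ... | no ¬ok = subst (λ d → suc d < lookup q w)
                       (degIn-K0-∉ (A ─ S) w (lookup-─-∈ {A = A} (lookup⇒∈ w∈S))) (≰⇒> ¬ok)
      counted⇒outside : ∀ w → χ (lookup A w ∧ (lookup q w ≤ᵇ k)) ≤ χ (lookup (A ─ S) w)
      counted⇒outside w rewrite lookup-─ A S w with lookup S w in w∈S
      ... | true  rewrite ≤ᵇ-false {lookup q w} {k} (S-above w w∈S) | Bool.∧-zeroʳ (lookup A w) = z≤n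
      ... | false with lookup A w
      ...   | true  = χ≤1 _
      ...   | false = z≤n

  isPFOn⇒≤card : ∀ A q → IsPFOn (K0 n) A q → ∀ v → v ∈ A → lookup q v ≤ card A
  isPFOn⇒≤card A q pf v v∈A with lookup q v ≤? card A
  ... | yes ok = ok
  ... | no ¬ok = ⊥-elim (<⇒≱ (countOn<card A q (∈⇒lookup v∈A) (≰⇒> ¬ok))
                             (proj₂ (isPFOn⇒classical A q pf) (card A) (nonempty⇒card≥1 (v , v∈A)) ≤-refl))

isPF⇔isGPF : ∀ n (p : Vec ℕ n) → IsPF n p ⇔ IsGPF (K0 n) p
isPF⇔isGPF n p = mk⇔ to from
  where
  to : IsPF n p → IsGPF (K0 n) p
  to (bounds , counts) = classical⇒isPFOn ⊤ p ((λ v _ → proj₁ (bounds v)) , λ k 1≤k k≤ →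
    subst (k ≤_) (sym (countOn-⊤ p k)) (counts k 1≤k (subst (k ≤_) (card-⊤ {n}) k≤)))
  from : IsGPF (K0 n) p → IsPF n p
  from gpf with isPFOn⇒classical ⊤ p gpf
  ... | pos , counts =
    (λ i → pos i ∈⊤ , subst (lookup p i ≤_) (card-⊤ {n}) (isPFOn⇒≤card ⊤ p gpf i ∈⊤)) ,
    λ k 1≤k k≤n → subst (k ≤_) (countOn-⊤ p k) (counts k 1≤k (subst (k ≤_) (sym (card-⊤ {n})) k≤n))

-- Prime parking functions

atMost : ∀ {n} → Vec ℕ n → ℕ → Subset n
atMost p j = tabulate λ w → lookup p w ≤ᵇ j

module _ {n : ℕ} (p : Vec ℕ n) where

  lookup-atMost : ∀ j w → lookup (atMost p j) w ≡ (lookup p w ≤ᵇ j)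
  lookup-atMost j = lookup∘tabulate (λ w → lookup p w ≤ᵇ j)

  card-atMost : ∀ j → card (atMost p j) ≡ countLe p j
  card-atMost j = trans (sum-cong-≗ (cong χ ∘ lookup-atMost j)) (sym (countLe-∑ p j))

  card-atMost-breakpoint : ∀ {j} → countLe p j ≡ j → card (atMost p j) ≡ j
  card-atMost-breakpoint {j} countLe≡j = trans (card-atMost j) countLe≡j

  shiftedBy : Subset n → Vec ℕ n
  shiftedBy A = tabulate λ v → lookup p v ∸ degIn (K0 n) A v

  lookup-shiftedBy-∉ : ∀ A w → lookup A w ≡ false → lookup (shiftedBy A) w ≡ lookup p w ∸ card A
  lookup-shiftedBy-∉ A w w∉A = trans (lookup∘tabulate _ w) (cong (lookup p w ∸_) (degIn-K0-∉ A w w∉A))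

  decomposable⇒breakpoint : ∀ A → Decomposable (K0 n) A p → Breakpoint n p (card A) × card A < n
  decomposable⇒breakpoint A (A≠∅ , ∁A≠∅ , pfA , pf∁A) =
    (nonempty⇒card≥1 A≠∅ , <⇒≤ |A|<n , countLe-|A|) , |A|<n
    where
    outside-above : ∀ w → lookup A w ≡ false → card A < lookup p w
    outside-above w w∉A = m∸n≢0⇒n<m λ e →
      1≰0 (subst (1 ≤_) (trans (lookup-shiftedBy-∉ A w w∉A) e) (proj₁ pf∁A w (lookup⇒∈∁ w∉A)))
      where
      1≰0 : ¬ 1 ≤ 0
      1≰0 ()
    countLe-|A| : countLe p (card A) ≡ card A
    countLe-|A| = trans (countLe-∑ p (card A)) (sum-cong-≗ pointwise)
      where
      pointwise : ∀ w → χ (lookup p w ≤ᵇ card A) ≡ χ (lookup A w)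
      pointwise w with lookup A w in w∈A
      ... | true  = cong χ (≤ᵇ-true (isPFOn⇒≤card A p pfA w (lookup⇒∈ w∈A)))
      ... | false = cong χ (≤ᵇ-false (outside-above w w∈A))
    |A|<n : card A < n
    |A|<n = let (w , w∈∁A) = ∁A≠∅ in #<n (lookup A) w (∈∁⇒lookup w∈∁A)

  countOn-above-breakpoint : ∀ j → countLe p j ≡ j → ∀ k →
    countOn (∁ (atMost p j)) (shiftedBy (atMost p j)) k + j ≡ countLe p (j + k)
  countOn-above-breakpoint j countLe≡j k = begin
    countOn (∁ A) q k + j                   ≡⟨ cong (_+_ (countOn (∁ A) q k)) |A|≡j ⟨
    countOn (∁ A) q k + card A              ≡⟨ ∑-distrib-+ _ (χ ∘ lookup A) ⟨
    ∑ (λ w → χ (lookup (∁ A) w ∧ (lookup q w ≤ᵇ k)) + χ (lookup A w)) ≡⟨ sum-cong-≗ pointwise ⟩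
    # (λ w → lookup p w ≤ᵇ j + k)           ≡⟨ countLe-∑ p (j + k) ⟨
    countLe p (j + k)                       ∎
    where
    open ≡-Reasoning
    A = atMost p j
    q = shiftedBy A
    |A|≡j : card A ≡ j
    |A|≡j = card-atMost-breakpoint countLe≡j
    pointwise : ∀ w → χ (lookup (∁ A) w ∧ (lookup q w ≤ᵇ k)) + χ (lookup A w) ≡ χ (lookup p w ≤ᵇ j + k)
    pointwise w rewrite lookup-∁ A w with lookup A w in w∈A
    ... | true  = sym (cong χ (≤ᵇ-true (≤-trans pw≤j (m≤m+n j k))))
      where pw≤j = ≤ᵇ-true⁻¹ {lookup p w} (trans (sym (lookup-atMost j w)) w∈A)
    ... | false rewrite lookup-shiftedBy-∉ A w w∈A | |A|≡j = trans (+-identityʳ _) (cong χ (∸-≤ᵇ (lookup p w) j k))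

  atMost-isPFOn : IsPF n p → ∀ j → countLe p j ≡ j → IsPFOn (K0 n) (atMost p j) p
  atMost-isPFOn (bounds , counts) j countLe≡j = classical⇒isPFOn A p ((λ v _ → proj₁ (bounds v)) , countsA)
    where
    A = atMost p j
    countsA : ∀ k → 1 ≤ k → k ≤ card A → k ≤ countOn A p k
    countsA k 1≤k k≤|A| = subst (k ≤_) (trans (countLe-∑ p k) (sum-cong-≗ pointwise))
                                (counts k 1≤k (≤-trans k≤j j≤n))
      where
      j≤n : j ≤ n
      j≤n = subst (_≤ n) (card-atMost-breakpoint countLe≡j) (#≤n (lookup A))
      k≤j : k ≤ j
      k≤j = subst (k ≤_) (card-atMost-breakpoint countLe≡j) k≤|A|
      pointwise : ∀ w → χ (lookup p w ≤ᵇ k) ≡ χ (lookup A w ∧ (lookup p w ≤ᵇ k))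
      pointwise w rewrite lookup-atMost j w with lookup p w ≤ᵇ k in pw≤k
      ... | true  rewrite ≤ᵇ-true (≤-trans (≤ᵇ-true⁻¹ {lookup p w} pw≤k) k≤j) = refl
      ... | false = cong χ (sym (Bool.∧-zeroʳ _))

  ∁atMost-isPFOn : IsPF n p → ∀ j → countLe p j ≡ j → IsPFOn (K0 n) (∁ (atMost p j)) (shiftedBy (atMost p j))
  ∁atMost-isPFOn (_ , counts) j countLe≡j = classical⇒isPFOn (∁ A) (shiftedBy A) (pos , counts∁A)
    where
    A = atMost p j
    |A|≡j : card A ≡ j
    |A|≡j = card-atMost-breakpoint countLe≡j
    pos : ∀ v → v ∈ ∁ A → 1 ≤ lookup (shiftedBy A) v
    pos v v∈∁A = subst (1 ≤_) (sym (trans (lookup-shiftedBy-∉ A v v∉A) (cong (lookup p v ∸_) |A|≡j)))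
                       (m<n⇒0<n∸m (≤ᵇ-false⁻¹ {lookup p v} (trans (sym (lookup-atMost j v)) v∉A)))
      where v∉A = ∈∁⇒lookup v∈∁A
    counts∁A : ∀ k → 1 ≤ k → k ≤ card (∁ A) → k ≤ countOn (∁ A) (shiftedBy A) k
    counts∁A k 1≤k k≤|∁A| = +-cancelʳ-≤ j k _ (begin
      k + j                               ≡⟨ +-comm k j ⟩
      j + k                               ≤⟨ counts (j + k) (≤-trans 1≤k (m≤n+m k j)) j+k≤n ⟩
      countLe p (j + k)                   ≡⟨ countOn-above-breakpoint j countLe≡j k ⟨
      countOn (∁ A) (shiftedBy A) k + j   ∎)
      where
      open ≤-Reasoning
      j+k≤n : j + k ≤ n
      j+k≤n = subst (j + k ≤_) (trans (cong (_+ card (∁ A)) (sym |A|≡j)) (card-∁ A)) (+-monoʳ-≤ j k≤|∁A|)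

  breakpoint⇒decomposable : IsPF n p → ∀ j → Breakpoint n p j → j < n → Decomposable (K0 n) (atMost p j) p
  breakpoint⇒decomposable pf j (1≤j , _ , countLe≡j) j<n =
    A≠∅ , ∁A≠∅ , atMost-isPFOn pf j countLe≡j , ∁atMost-isPFOn pf j countLe≡j
    where
    A = atMost p j
    |A|≡j : card A ≡ j
    |A|≡j = card-atMost-breakpoint countLe≡j
    A≠∅ : Nonempty A
    A≠∅ = let (w , w∈A) = #-pos⇒true (lookup A) (subst (1 ≤_) (sym |A|≡j) 1≤j) in w , lookup⇒∈ w∈A
    ∁A≠∅ : Nonempty (∁ A)
    ∁A≠∅ = let (w , w∉A) = #<n⇒false (lookup A) (subst (_< n) (sym |A|≡j) j<n) in w , lookup⇒∈∁ w∉A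

isPrimePF⇔isPrimeGPF : ∀ n (p : Vec ℕ n) → IsPrimePF n p ⇔ IsPrimeGPF (K0 n) p
isPrimePF⇔isPrimeGPF n p = mk⇔ to from
  where
  to : IsPrimePF n p → IsPrimeGPF (K0 n) p
  to (pf , onlyBreakpointN) = Equivalence.to (isPF⇔isGPF n p) pf , λ A dec →
    let (brk , |A|<n) = decomposable⇒breakpoint p A dec in <⇒≢ |A|<n (onlyBreakpointN (card A) brk)
  from : IsPrimeGPF (K0 n) p → IsPrimePF n p
  from (gpf , indecomposable) = pf , onlyBreakpointN
    where
    pf : IsPF n p
    pf = Equivalence.from (isPF⇔isGPF n p) gpf
    onlyBreakpointN : ∀ j → Breakpoint n p j → j ≡ n
    onlyBreakpointN j brk@(_ , j≤n , _) with j <? n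
    ... | yes j<n = ⊥-elim (indecomposable (atMost p j) (breakpoint⇒decomposable p pf j brk j<n))
    ... | no j≮n  = ≤-antisym j≤n (≮⇒≥ j≮n)

InRange : ℕ → ℕ → Set
InRange m x = 1 ≤ x × x ≤ m

StrictlyParks : (n : ℕ) → Vec ℕ n → Set
StrictlyParks n p = ∀ j → 1 ≤ j → j < n → j < countLe p j

countLe-all : ∀ {n} (p : Vec ℕ n) j → (∀ i → lookup p i ≤ j) → countLe p j ≡ n
countLe-all {n} p j p≤j = trans (countLe-∑ p j) (trans (sum-cong-≗ (cong χ ∘ ≤ᵇ-true ∘ p≤j)) (∑-ones n))

isPrimePF⇔strict : ∀ n (p : Vec ℕ n) → IsPrimePF n p ⇔ ((∀ i → InRange n (lookup p i)) × StrictlyParks n p)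
isPrimePF⇔strict n p = mk⇔ to from
  where
  to : IsPrimePF n p → (∀ i → InRange n (lookup p i)) × StrictlyParks n p
  to ((bounds , counts) , onlyBreakpointN) = bounds , strict
    where
    strict : StrictlyParks n p
    strict j 1≤j j<n with countLe p j ℕ.≟ j
    ... | yes brk = contradiction (onlyBreakpointN j (1≤j , <⇒≤ j<n , brk)) (<⇒≢ j<n)
    ... | no ¬brk = ≤∧≢⇒< (counts j 1≤j (<⇒≤ j<n)) (¬brk ∘ sym)
  from : (∀ i → InRange n (lookup p i)) × StrictlyParks n p → IsPrimePF n p
  from (bounds , strict) = (bounds , counts) , onlyBreakpointN
    where
    counts : ∀ j → 1 ≤ j → j ≤ n → j ≤ countLe p j
    counts j 1≤j j≤n with j <? n
    ... | yes j<n = <⇒≤ (strict j 1≤j j<n)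
    ... | no j≮n  = subst (j ≤_) (sym (countLe-all p j λ i → ≤-trans (proj₂ (bounds i)) j≥n)) j≤n
      where j≥n = ≮⇒≥ j≮n
    onlyBreakpointN : ∀ j → Breakpoint n p j → j ≡ n
    onlyBreakpointN j (1≤j , j≤n , brk) with j <? n
    ... | yes j<n = contradiction (strict j 1≤j j<n) (<-irrefl (sym brk))
    ... | no j≮n  = ≤-antisym j≤n (≮⇒≥ j≮n)

countLe≥n⇒≤ : ∀ {n} (p : Vec ℕ n) j → n ≤ countLe p j → ∀ i → lookup p i ≤ j
countLe≥n⇒≤ p j n≤count i =
  ≤ᵇ-true⁻¹ {lookup p i} (#≥n⇒true (λ k → lookup p k ≤ᵇ j) (subst (_ ≤_) (countLe-∑ p j) n≤count) i)

-- Recurrent configurations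

+-minus-≥ : ∀ {n x} → x ≤ n → + n ℤ.- + x ≡ + (n ∸ x)
+-minus-≥ {n} {x} x≤n = trans (ℤ.m-n≡m⊖n n x) (ℤ.⊖-≥ x≤n)

+-minus-< : ∀ {n x} → n < x → ∃[ k ] (+ n ℤ.- + x ≡ -[1+ k ])
+-minus-< {n} {x} n<x with x ∸ n | m<n⇒0<n∸m n<x | trans (ℤ.m-n≡m⊖n n x) (ℤ.⊖-< n<x)
... | suc k | _ | e = k , e

≤-minus⇒ : ∀ d n x → + d ℤ.≤ + n ℤ.- + x → d + x ≤ n
≤-minus⇒ d n x h with x ≤? n
... | yes x≤n = m≤o∸n⇒m+n≤o d x≤n (ℤ.drop‿+≤+ (subst (+ d ℤ.≤_) (+-minus-≥ x≤n) h))
... | no x≰n with +-minus-< {n} {x} (≰⇒> x≰n)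
...   | k , e with subst (+ d ℤ.≤_) e h
...     | ()

≤-minus⇐ : ∀ d n x → d + x ≤ n → + d ℤ.≤ + n ℤ.- + x
≤-minus⇐ d n x h = subst (+ d ℤ.≤_) (sym (+-minus-≥ (m+n≤o⇒n≤o d h))) (ℤ.+≤+ (m+n≤o⇒m≤o∸n d h))

minus-<⇒ : ∀ n x → + n ℤ.- + x ℤ.< + n → 1 ≤ x
minus-<⇒ n zero    h = contradiction (subst (ℤ._< + n) (+-minus-≥ {n} {0} z≤n) h) (ℤ.<-irrefl refl)
minus-<⇒ n (suc x) h = s≤s z≤n

minus-<⇐ : ∀ n x → 1 ≤ x → + n ℤ.- + x ℤ.< + n
minus-<⇐ n x 1≤x with x ≤? n
... | yes x≤n = subst (ℤ._< + n) (sym (+-minus-≥ x≤n)) (ℤ.+<+ (∸-monoʳ-< {n} {x} {0} 1≤x x≤n))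
... | no x≰n  = subst (ℤ._< + n) (sym (proj₂ (+-minus-< {n} {x} (≰⇒> x≰n)))) ℤ.-<+

-- c = deg − p, every vertex of K⁰ₙ having degree n
module _ {n : ℕ} where

  toConfig : Vec ℕ n → Vec ℤ n
  toConfig p = tabulate λ v → + n ℤ.- + lookup p v

  lookup-toConfig : ∀ (p : Vec ℕ n) v → lookup (toConfig p) v ≡ + n ℤ.- + lookup p v
  lookup-toConfig p = lookup∘tabulate _

  toConfig-injective : ∀ {p q : Vec ℕ n} → toConfig p ≡ toConfig q → p ≡ q
  toConfig-injective {p} {q} e = trans (sym (tabulate∘lookup p)) (trans (tabulate-cong same) (tabulate∘lookup q))
    where
    same : ∀ v → lookup p v ≡ lookup q v
    same v = ℤ.+-injective (ℤ.neg-injective (+-cancelˡ (+ n) _ _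
               (trans (sym (lookup-toConfig p v)) (trans (cong (λ c → lookup c v) e) (lookup-toConfig q v)))))

  stable⇔positive : ∀ (p : Vec ℕ n) → Stable (K0 n) (toConfig p) ⇔ (∀ v → 1 ≤ lookup p v)
  stable⇔positive p = mk⇔
    (λ st v → minus-<⇒ n (lookup p v) (subst₂ ℤ._<_ (lookup-toConfig p v) (cong +_ (deg-K0 v)) (st v)))
    (λ pos v → subst₂ ℤ._<_ (sym (lookup-toConfig p v)) (cong +_ (sym (deg-K0 v))) (minus-<⇐ n (lookup p v) (pos v)))

-- prefix σ i (from Defs) is imageWhere σ (λ j → toℕ j <ᵇ toℕ i) (allFin n) by definition.
module _ {m : ℕ} (σ : Fin m → Fin m) (c : Fin m → Bool) where

  imageWhere : ∀ {k} → Vec (Fin m) k → Subset m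
  imageWhere = foldr _ (λ j acc → if c j then ⁅ σ j ⁆ ∪ acc else acc) ⊥

  imageWhere-sound : ∀ {k} (xs : Vec (Fin m) k) w → lookup (imageWhere xs) w ≡ true → ∃[ j ] (c j ≡ true × σ j ≡ w)
  imageWhere-sound []       w e = contradiction (trans (sym (lookup-replicate w false)) e) λ ()
  imageWhere-sound (j ∷ xs) w e with c j in cj
  ... | false = imageWhere-sound xs w e
  ... | true with σ j ≟ᶠ w | trans (sym (lookup-zipWith _∨_ w ⁅ σ j ⁆ (imageWhere xs))) e
  ...   | yes σj≡w | _ = j , cj , σj≡w
  ...   | no σj≢w  | e′ rewrite lookup-⁅⁆ (σ j) w | dec-false (σ j ≟ᶠ w) σj≢w = imageWhere-sound xs w e′

  imageWhere-complete : ∀ {k} (xs : Vec (Fin m) k) j → j ∈ᵥ xs → c j ≡ true → lookup (imageWhere xs) (σ j) ≡ true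
  imageWhere-complete (x ∷ xs) j (here refl) cj rewrite cj =
    trans (lookup-zipWith _∨_ (σ j) ⁅ σ j ⁆ (imageWhere xs))
          (cong (_∨ lookup (imageWhere xs) (σ j)) (trans (lookup-⁅⁆ (σ j) (σ j)) (dec-true (σ j ≟ᶠ σ j) refl)))
  imageWhere-complete (x ∷ xs) j (there j∈xs) cj with c x
  ... | false = imageWhere-complete xs j j∈xs cj
  ... | true  = trans (lookup-zipWith _∨_ (σ j) ⁅ σ x ⁆ (imageWhere xs))
                      (trans (cong (lookup ⁅ σ x ⁆ (σ j) ∨_) (imageWhere-complete xs j j∈xs cj)) (Bool.∨-zeroʳ _))

  card-imageWhere : Injective _≡_ _≡_ σ → card (imageWhere (allFin m)) ≡ # c
  card-imageWhere σ-inj = begin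
    card P                     ≡⟨ sum-cong-≗ χ-as-sum ⟩
    ∑ (λ w → ∑ (λ j → hit j w)) ≡⟨ ∑-comm (λ w j → hit j w) ⟩
    ∑ (λ j → ∑ (hit j))        ≡⟨ sum-cong-≗ hits-of ⟩
    # c                        ∎
    where
    open ≡-Reasoning
    P = imageWhere (allFin m)
    hit : Fin m → Fin m → ℕ
    hit j w = if c j then (if does (σ j ≟ᶠ w) then 1 else 0) else 0
    hits-of : ∀ j → ∑ (hit j) ≡ χ (c j)
    hits-of j with c j
    ... | true  = ∑-select (σ j) (λ _ → 1)
    ... | false = ∑-zeros m
    χ-as-sum : ∀ w → χ (lookup P w) ≡ ∑ (λ j → hit j w)
    χ-as-sum w with lookup P w in w∈P
    ... | true  = let (j₀ , cj₀ , σj₀≡w) = imageWhere-sound (allFin m) w w∈P in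
                  sym (trans (sum-cong-≗ (only j₀ cj₀ σj₀≡w)) (∑-select j₀ (λ _ → 1)))
      where
      only : ∀ j₀ → c j₀ ≡ true → σ j₀ ≡ w → ∀ j → hit j w ≡ (if does (j₀ ≟ᶠ j) then 1 else 0)
      only j₀ cj₀ σj₀≡w j with j₀ ≟ᶠ j
      ... | yes refl rewrite cj₀ | σj₀≡w = cong (λ b → if b then 1 else 0) (dec-true (w ≟ᶠ w) refl)
      ... | no j₀≢j with c j
      ...   | false = refl
      ...   | true with σ j ≟ᶠ w
      ...     | yes σj≡w = contradiction (σ-inj (trans σj₀≡w (sym σj≡w))) j₀≢j
      ...     | no _     = refl
    ... | false = sym (trans (sum-cong-≗ none) (∑-zeros m))
      where
      none : ∀ j → hit j w ≡ 0
      none j with c j in cj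
      ... | false = refl
      ... | true with σ j ≟ᶠ w
      ...   | yes refl = contradiction (trans (sym (imageWhere-complete (allFin m) j (∈-allFin⁺ j) cj)) w∈P) λ ()
      ...   | no _     = refl

#-toℕ< : ∀ {m} t → t ≤ m → # {m} (λ j → toℕ j <ᵇ t) ≡ t
#-toℕ< {zero}  zero    _         = refl
#-toℕ< {suc m} zero    _         = ∑-zeros (suc m)
#-toℕ< {suc m} (suc t) (s≤s t≤m) = cong suc (#-toℕ< t t≤m)

module _ {n : ℕ} (σ : Fin n → Fin n) (σ-inj : Injective _≡_ _≡_ σ) (i : Fin n) where

  card-prefix : card (prefix σ i) ≡ toℕ i
  card-prefix = trans (card-imageWhere σ (λ j → toℕ j <ᵇ toℕ i) σ-inj) (#-toℕ< (toℕ i) (<⇒≤ (toℕ<n i)))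

  prefix-sound : ∀ w → lookup (prefix σ i) w ≡ true → ∃[ j ] (toℕ j < toℕ i × σ j ≡ w)
  prefix-sound w w∈ = let (j , j<i , σj≡w) = imageWhere-sound σ _ (allFin n) w w∈ in
                      j , ≤ᵇ-true⁻¹ {suc (toℕ j)} j<i , σj≡w

  σ∉prefix : lookup (prefix σ i) (σ i) ≡ false
  σ∉prefix with lookup (prefix σ i) (σ i) in σi∈
  ... | false = refl
  ... | true with prefix-sound (σ i) σi∈
  ...   | j , j<i , σj≡σi = contradiction (cong toℕ (σ-inj σj≡σi)) (<⇒≢ j<i)

  degIn-∁prefix : degIn (K0 n) (∁ (prefix σ i)) (σ i) + suc (toℕ i) ≡ n
  degIn-∁prefix = begin
    d + suc (toℕ i)                      ≡⟨ +-suc d (toℕ i) ⟩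
    suc d + toℕ i                        ≡⟨ cong₂ _+_ (degIn-K0-∈ (∁ P) (σ i) σi∈∁P) (sym card-prefix) ⟩
    card (∁ P) + card P                  ≡⟨ +-comm (card (∁ P)) (card P) ⟩
    card P + card (∁ P)                  ≡⟨ card-∁ P ⟩
    n                                    ∎
    where
    open ≡-Reasoning
    P = prefix σ i
    d = degIn (K0 n) (∁ P) (σ i)
    σi∈∁P : lookup (∁ P) (σ i) ≡ true
    σi∈∁P = trans (lookup-∁ P (σ i)) (cong not σ∉prefix)

  toppling-condition⇔ : ∀ x → (+ degIn (K0 n) (∁ (prefix σ i)) (σ i) ℤ.≤ + n ℤ.- + x) ⇔ (x ≤ suc (toℕ i))
  toppling-condition⇔ x = mk⇔
    (λ h → +-cancelˡ-≤ d x (suc (toℕ i)) (subst (d + x ≤_) (sym degIn-∁prefix) (≤-minus⇒ d n x h)))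
    (λ h → ≤-minus⇐ d n x (subst (d + x ≤_) degIn-∁prefix (+-monoʳ-≤ d h)))
    where d = degIn (K0 n) (∁ (prefix σ i)) (σ i)

injective⇒surjective : ∀ {n} (f : Fin n → Fin n) → Injective _≡_ _≡_ f → ∀ y → ∃[ x ] f x ≡ y
injective⇒surjective {suc n} f f-inj y with any? (λ x → f x ≟ᶠ y)
... | yes hit   = hit
... | no missed = contradiction (injective⇒≤ g-inj) 1+n≰n
  where
  g : Fin (suc n) → Fin n
  g x = punchOut {i = y} {j = f x} (λ y≡fx → missed (x , sym y≡fx))
  g-inj : Injective _≡_ _≡_ g
  g-inj {x} {x′} e = f-inj (punchOut-injective {i = y} (λ y≡fx → missed (x , sym y≡fx))
                                                      (λ y≡fx′ → missed (x′ , sym y≡fx′)) e)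

*+-injectiveʳ : ∀ n a b {i j} → i < n → j < n → a * n + i ≡ b * n + j → i ≡ j
*+-injectiveʳ n zero    zero    i<n j<n e = e
*+-injectiveʳ n zero    (suc b) i<n j<n e =
  contradiction (subst (n ≤_) (sym e) (≤-trans (m≤m+n n (b * n)) (m≤m+n _ _))) (<⇒≱ i<n)
*+-injectiveʳ n (suc a) zero    i<n j<n e =
  contradiction (subst (n ≤_) e (≤-trans (m≤m+n n (a * n)) (m≤m+n _ _))) (<⇒≱ j<n)
*+-injectiveʳ n (suc a) (suc b) {i} {j} i<n j<n e =
  *+-injectiveʳ n a b i<n j<n (+-cancelˡ-≡ n _ _ (trans (sym (+-assoc n (a * n) i)) (trans e (+-assoc n (b * n) j))))

-- Sorting by the key p v · n + v lists the vertices by value, ties broken by index.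
module Ranking {n : ℕ} (p : Vec ℕ n) where

  key : Fin n → ℕ
  key v = lookup p v * n + toℕ v

  key-injective : ∀ {v w} → key v ≡ key w → v ≡ w
  key-injective {v} {w} e = toℕ-injective (*+-injectiveʳ n (lookup p v) (lookup p w) (toℕ<n v) (toℕ<n w) e)

  key-mono : ∀ v w → lookup p w < lookup p v → key w < key v
  key-mono v w pw<pv = begin-strict
    lookup p w * n + toℕ w       <⟨ +-monoʳ-< (lookup p w * n) (toℕ<n w) ⟩
    lookup p w * n + n           ≡⟨ +-comm (lookup p w * n) n ⟩
    suc (lookup p w) * n         ≤⟨ *-monoˡ-≤ n pw<pv ⟩
    lookup p v * n               ≤⟨ m≤m+n _ (toℕ v) ⟩
    lookup p v * n + toℕ v       ∎
    where open ≤-Reasoning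

  rank : Fin n → ℕ
  rank v = # (λ w → key w <ᵇ key v)

  rank<n : ∀ v → rank v < n
  rank<n v = #<n (λ w → key w <ᵇ key v) v (≤ᵇ-false {suc (key v)} ≤-refl)

  rank-mono : ∀ v w → key v < key w → rank v < rank w
  rank-mono v w kv<kw =
    ∑-mono-< below v (subst₂ (λ a b → χ a < χ b) (sym (≤ᵇ-false {suc (key v)} ≤-refl)) (sym (≤ᵇ-true kv<kw)) ≤-refl)
    where
    below : ∀ u → χ (key u <ᵇ key v) ≤ χ (key u <ᵇ key w)
    below u with key u <ᵇ key v in ku<kv
    ... | true  = ≤-reflexive (cong χ (sym (≤ᵇ-true (<-trans (≤ᵇ-true⁻¹ {suc (key u)} ku<kv) kv<kw))))
    ... | false = z≤n

  rank-injective : ∀ {v w} → rank v ≡ rank w → v ≡ w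
  rank-injective {v} {w} e with <-cmp (key v) (key w)
  ... | tri< kv<kw _ _ = contradiction e (<⇒≢ (rank-mono v w kv<kw))
  ... | tri≈ _ kv≡kw _ = key-injective kv≡kw
  ... | tri> _ _ kv>kw = contradiction (sym e) (<⇒≢ (rank-mono w v kv>kw))

  rankFin : Fin n → Fin n
  rankFin v = fromℕ< (rank<n v)

  rankFin-injective : Injective _≡_ _≡_ rankFin
  rankFin-injective {v} {w} e =
    rank-injective (trans (sym (toℕ-fromℕ< (rank<n v))) (trans (cong toℕ e) (toℕ-fromℕ< (rank<n w))))

  order : Fin n → Fin n
  order i = proj₁ (injective⇒surjective rankFin rankFin-injective i)

  rank-order : ∀ i → rank (order i) ≡ toℕ i
  rank-order i = trans (sym (toℕ-fromℕ< (rank<n (order i))))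
                       (cong toℕ (proj₂ (injective⇒surjective rankFin rankFin-injective i)))

  order-injective : Injective _≡_ _≡_ order
  order-injective {i} {j} e = toℕ-injective (trans (sym (rank-order i)) (trans (cong rank e) (rank-order j)))

  countLe-below≤rank : ∀ v → 1 ≤ lookup p v → countLe p (lookup p v ∸ 1) ≤ rank v
  countLe-below≤rank v 1≤pv = subst (_≤ rank v) (sym (countLe-∑ p _)) (∑-mono-≤ below)
    where
    below : ∀ w → χ (lookup p w ≤ᵇ lookup p v ∸ 1) ≤ χ (key w <ᵇ key v)
    below w with lookup p w ≤ᵇ lookup p v ∸ 1 in pw<pv
    ... | false = z≤n
    ... | true  = ≤-reflexive (cong χ (sym (≤ᵇ-true (key-mono v w
                    (m≤pred[n]⇒suc[m]≤n {{>-nonZero 1≤pv}} (≤ᵇ-true⁻¹ {lookup p w} pw<pv))))))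

module _ {n : ℕ} (p : Vec ℕ n) where

  toppling⇔ : ∀ (σ : Fin n → Fin n) (σ-inj : Injective _≡_ _≡_ σ) i →
    (+ degIn (K0 n) (∁ (prefix σ i)) (σ i) ℤ.≤ lookup (toConfig p) (σ i)) ⇔ (lookup p (σ i) ≤ suc (toℕ i))
  toppling⇔ σ σ-inj i = mk⇔
    (λ h → Equivalence.to   (toppling-condition⇔ σ σ-inj i _) (subst (_ ℤ.≤_) (lookup-toConfig p (σ i)) h))
    (λ h → subst (_ ℤ.≤_) (sym (lookup-toConfig p (σ i))) (Equivalence.from (toppling-condition⇔ σ σ-inj i _) h))

  recurrent⇒isPF : Recurrent (K0 n) (toConfig p) → IsPF n p
  recurrent⇒isPF (stable , σ , σ-inj , topples) = (λ v → positive v , upper v) , counts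
    where
    positive : ∀ v → 1 ≤ lookup p v
    positive = Equivalence.to (stable⇔positive p) stable
    bound : ∀ i → lookup p (σ i) ≤ suc (toℕ i)
    bound i = Equivalence.to (toppling⇔ σ σ-inj i) (topples i)
    upper : ∀ v → lookup p v ≤ n
    upper v with injective⇒surjective σ σ-inj v
    ... | i , refl = ≤-trans (bound i) (toℕ<n i)
    counts : ∀ j → 1 ≤ j → j ≤ n → j ≤ countLe p j
    counts j _ j≤n with j <? n
    ... | no j≮n  = subst (j ≤_) (sym (countLe-all p j λ v → ≤-trans (upper v) (≮⇒≥ j≮n))) j≤n
    ... | yes j<n = begin
      j                    ≡⟨ toℕ-fromℕ< j<n ⟨
      toℕ i                ≡⟨ card-prefix σ σ-inj i ⟨
      card (prefix σ i)    ≤⟨ ∑-mono-≤ prefix-parked ⟩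
      # (λ w → lookup p w ≤ᵇ j) ≡⟨ countLe-∑ p j ⟨
      countLe p j          ∎
      where
      open ≤-Reasoning
      i = fromℕ< j<n
      prefix-parked : ∀ w → χ (lookup (prefix σ i) w) ≤ χ (lookup p w ≤ᵇ j)
      prefix-parked w with lookup (prefix σ i) w in w∈
      ... | false = z≤n
      ... | true with prefix-sound σ σ-inj i w w∈
      ...   | x , x<i , refl = ≤-reflexive (cong χ (sym (≤ᵇ-true (≤-trans (bound x)
                                 (subst (suc (toℕ x) ≤_) (toℕ-fromℕ< j<n) x<i)))))

  isPF⇒recurrent : IsPF n p → Recurrent (K0 n) (toConfig p)
  isPF⇒recurrent (bounds , counts) =
    Equivalence.from (stable⇔positive p) (proj₁ ∘ bounds) , order , order-injective , topples
    where
    open Ranking p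
    bound : ∀ v → lookup p v ≤ suc (rank v)
    bound v with lookup p v | bounds v | countLe-below≤rank v (proj₁ (bounds v))
    ... | suc zero    | _       | _        = s≤s z≤n
    ... | suc (suc k) | (_ , ≤n) | below≤rank =
      s≤s (≤-trans (counts (suc k) (s≤s z≤n) (≤-trans (n≤1+n _) ≤n)) below≤rank)
    topples : ∀ i → + degIn (K0 n) (∁ (prefix order i)) (order i) ℤ.≤ lookup (toConfig p) (order i)
    topples i = Equivalence.from (toppling⇔ order order-injective i)
                  (subst (λ r → lookup p (order i) ≤ suc r) (rank-order i) (bound (order i)))

-- Strongly recurrent configurations

module _ {n : ℕ} where

  raiseExcept : Fin n → Vec ℕ n → Vec ℕ n
  raiseExcept v p = tabulate λ w → if does (w ≟ᶠ v) then lookup p w else suc (lookup p w)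

  lookup-raiseExcept : ∀ v p w → lookup (raiseExcept v p) w ≡ (if does (w ≟ᶠ v) then lookup p w else suc (lookup p w))
  lookup-raiseExcept v p = lookup∘tabulate _

  minusAt-toConfig : ∀ p v → minusAt (K0 n) (toConfig p) v ≡ toConfig (raiseExcept v p)
  minusAt-toConfig p v = tabulate-cong pointwise
    where
    minus-suc : ∀ (a b : ℤ) → (a ℤ.- b) ℤ.- + 1 ≡ a ℤ.- (+ 1 ℤ.+ b)
    minus-suc = ℤ-Solver.solve-∀
    pointwise : ∀ w → (if does (w ≟ᶠ v) then lookup (toConfig p) w else lookup (toConfig p) w ℤ.- + 1)
                    ≡ + n ℤ.- + lookup (raiseExcept v p) w
    pointwise w rewrite lookup-raiseExcept v p w | lookup-toConfig p w with does (w ≟ᶠ v)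
    ... | true  = refl
    ... | false = minus-suc (+ n) (+ lookup p w)

  inVM⇔≤1 : ∀ p v → InVM (K0 n) (toConfig p) v ⇔ lookup p v ≤ 1
  inVM⇔≤1 p v = mk⇔ to from
    where
    n-1 : ℕ
    n-1 = n ∸ 1
    n≥1 : 1 ≤ n
    n≥1 = ≤-trans (s≤s z≤n) (toℕ<n v)
    threshold : + deg (K0 n) v ℤ.- + 1 ≡ + n-1
    threshold = trans (cong (λ d → + d ℤ.- + 1) (deg-K0 v)) (+-minus-≥ n≥1)
    n≡ : n-1 + 1 ≡ n
    n≡ = m∸n+n≡m n≥1
    to : InVM (K0 n) (toConfig p) v → lookup p v ≤ 1
    to (_ , h) = +-cancelˡ-≤ n-1 (lookup p v) 1 (subst (n-1 + lookup p v ≤_) (sym n≡)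
                   (≤-minus⇒ n-1 n (lookup p v) (subst₂ ℤ._≤_ threshold (lookup-toConfig p v) h)))
    from : lookup p v ≤ 1 → InVM (K0 n) (toConfig p) v
    from pv≤1 = s≤s z≤n , subst₂ ℤ._≤_ (sym threshold) (sym (lookup-toConfig p v))
                  (≤-minus⇐ n-1 n (lookup p v) (subst (n-1 + lookup p v ≤_) n≡ (+-monoʳ-≤ n-1 pv≤1)))

  countLe-raiseExcept : ∀ p v → lookup p v ≡ 1 → ∀ j → 1 ≤ j → countLe (raiseExcept v p) (suc j) ≡ countLe p j
  countLe-raiseExcept p v pv≡1 j 1≤j =
    trans (countLe-∑ (raiseExcept v p) (suc j)) (trans (sum-cong-≗ pointwise) (sym (countLe-∑ p j)))
    where
    pointwise : ∀ w → χ (lookup (raiseExcept v p) w ≤ᵇ suc j) ≡ χ (lookup p w ≤ᵇ j)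
    pointwise w rewrite lookup-raiseExcept v p w with w ≟ᶠ v
    ... | yes refl rewrite pv≡1 = cong χ (sym (≤ᵇ-true 1≤j))
    ... | no _     = cong χ (≤ᵇ-suc (lookup p w) j)

  stronglyRecurrent⇒isPrimePF : ∀ p → StronglyRecurrent (K0 n) (toConfig p) → IsPrimePF n p
  stronglyRecurrent⇒isPrimePF p (recurrent , recurrent-at) =
    Equivalence.from (isPrimePF⇔strict n p) (proj₁ pf , strict)
    where
    pf : IsPF n p
    pf = recurrent⇒isPF p recurrent
    strict : StrictlyParks n p
    strict j 1≤j j<n = subst (suc j ≤_) (countLe-raiseExcept p v pv≡1 j 1≤j)
                             (proj₂ pf′ (suc j) (s≤s z≤n) j<n)
      where
      v-at1 : ∃[ v ] (lookup p v ≤ᵇ 1) ≡ true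
      v-at1 = #-pos⇒true (λ w → lookup p w ≤ᵇ 1)
                (subst (1 ≤_) (countLe-∑ p 1) (proj₂ pf 1 ≤-refl (≤-trans 1≤j (<⇒≤ j<n))))
      v = proj₁ v-at1
      pv≡1 : lookup p v ≡ 1
      pv≡1 = ≤-antisym (≤ᵇ-true⁻¹ {lookup p v} (proj₂ v-at1)) (proj₁ (proj₁ pf v))
      pf′ : IsPF n (raiseExcept v p)
      pf′ = recurrent⇒isPF (raiseExcept v p) (subst (Recurrent (K0 n)) (minusAt-toConfig p v)
              (recurrent-at v (Equivalence.from (inVM⇔≤1 p v) (≤-reflexive pv≡1))))

  isPrimePF⇒stronglyRecurrent : ∀ p → IsPrimePF n p → StronglyRecurrent (K0 n) (toConfig p)
  isPrimePF⇒stronglyRecurrent p prime = isPF⇒recurrent p (proj₁ prime) , recurrent-at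
    where
    bounds : ∀ i → InRange n (lookup p i)
    bounds = proj₁ (Equivalence.to (isPrimePF⇔strict n p) prime)
    strict : StrictlyParks n p
    strict = proj₂ (Equivalence.to (isPrimePF⇔strict n p) prime)
    recurrent-at : ∀ v → InVM (K0 n) (toConfig p) v → Recurrent (K0 n) (minusAt (K0 n) (toConfig p) v)
    recurrent-at v v∈VM = subst (Recurrent (K0 n)) (sym (minusAt-toConfig p v))
                            (isPF⇒recurrent q ((λ w → positive w , upper w) , counts))
      where
      q = raiseExcept v p
      pv≡1 : lookup p v ≡ 1
      pv≡1 = ≤-antisym (Equivalence.to (inVM⇔≤1 p v) v∈VM) (proj₁ (bounds v))
      positive : ∀ w → 1 ≤ lookup q w
      positive w rewrite lookup-raiseExcept v p w with does (w ≟ᶠ v)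
      ... | true  = proj₁ (bounds w)
      ... | false = s≤s z≤n
      counts : ∀ j → 1 ≤ j → j ≤ n → j ≤ countLe q j
      counts (suc zero) _ _ =
        subst (1 ≤_) (sym (countLe-∑ q 1)) (≤-trans (≤-reflexive (sym qv≤1)) (term≤∑ (λ w → χ (lookup q w ≤ᵇ 1)) v))
        where
        qv≤1 : χ (lookup q v ≤ᵇ 1) ≡ 1
        qv≤1 rewrite lookup-raiseExcept v p v | dec-true (v ≟ᶠ v) refl | pv≡1 = refl
      counts (suc (suc j)) _ j+2≤n = subst (suc (suc j) ≤_) (sym (countLe-raiseExcept p v pv≡1 (suc j) (s≤s z≤n)))
                                          (strict (suc j) (s≤s z≤n) j+2≤n)
      upper : ∀ w → lookup q w ≤ n
      upper = countLe≥n⇒≤ q n (counts n (≤-trans (s≤s z≤n) (toℕ<n v)) ≤-refl)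

  fromConfig : Vec ℤ n → Vec ℕ n
  fromConfig c = tabulate λ v → ℤ.∣ + n ℤ.- lookup c v ∣

  stable⇒toConfig∘fromConfig : ∀ c → Stable (K0 n) c → toConfig (fromConfig c) ≡ c
  stable⇒toConfig∘fromConfig c stable = trans (tabulate-cong pointwise) (tabulate∘lookup c)
    where
    minus-minus : ∀ (a b : ℤ) → a ℤ.- (a ℤ.- b) ≡ b
    minus-minus = ℤ-Solver.solve-∀
    pointwise : ∀ v → + n ℤ.- + lookup (fromConfig c) v ≡ lookup c v
    pointwise v rewrite lookup∘tabulate (λ v → ℤ.∣ + n ℤ.- lookup c v ∣) v
                      | ℤ.0≤i⇒+∣i∣≡i (ℤ.i≤j⇒0≤j-i (ℤ.<⇒≤ (subst (lookup c v ℤ.<_) (cong +_ (deg-K0 v)) (stable v))))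
                      = minus-minus (+ n) (lookup c v)

-- Cardinalities

map-unique : ∀ {A B : Set} (f : A → B) {xs} → (∀ {x y} → x ∈ₗ xs → y ∈ₗ xs → f x ≡ f y → x ≡ y) →
             Unique xs → Unique (List.map f xs)
map-unique f {[]}     _   []           = []
map-unique f {x ∷ xs} inj (x∉xs ∷ xs!) =
  ListAll.map⁺ (ListAll.tabulate λ y∈xs fx≡fy → ListAll.lookup x∉xs y∈xs (inj (here refl) (there y∈xs) fx≡fy))
  ∷ map-unique f (λ x∈ y∈ → inj (there x∈) (there y∈)) xs!

HasCard-image : ∀ {A B : Set} {P : A → Set} {Q : B → Set} {k} (f : A → B) →
  (∀ {x y} → P x → P y → f x ≡ f y → x ≡ y) →
  (∀ x → P x → Q (f x)) →
  (∀ y → Q y → ∃[ x ] (P x × f x ≡ y)) →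
  HasCard P k → HasCard Q k
HasCard-image {P = P} {Q} f f-inj f-into f-onto (xs , xs! , ∈xs⇔P , |xs|≡k) =
  List.map f xs , map-unique f (λ x∈ y∈ → f-inj (P-of x∈) (P-of y∈)) xs! , ∈⇔Q , trans (length-map f xs) |xs|≡k
  where
  P-of : ∀ {x} → x ∈ₗ xs → P x
  P-of {x} = Equivalence.to (∈xs⇔P x)
  ∈-of : ∀ {x} → P x → x ∈ₗ xs
  ∈-of {x} = Equivalence.from (∈xs⇔P x)
  ∈⇔Q : ∀ y → y ∈ₗ List.map f xs ⇔ Q y
  ∈⇔Q y = mk⇔ (λ y∈ → let (x , x∈ , y≡fx) = ∈-map⁻ f y∈ in subst Q (sym y≡fx) (f-into x (P-of x∈)))
              (λ Qy → let (x , Px , fx≡y) = f-onto y Qy in subst (_∈ₗ List.map f xs) fx≡y (∈-map⁺ f (∈-of Px)))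

length-cartesianProductWith : ∀ {A B C : Set} (f : A → B → C) xs ys →
  length (cartesianProductWith f xs ys) ≡ length xs * length ys
length-cartesianProductWith f []       ys = refl
length-cartesianProductWith f (x ∷ xs) ys =
  trans (length-++ (List.map (f x) ys)) (cong₂ _+_ (length-map (f x) ys) (length-cartesianProductWith f xs ys))

module _ {A : Set} (xs : List A) where

  vectorsOver : (N : ℕ) → List (Vec A N)
  vectorsOver zero    = [] ∷ []
  vectorsOver (suc N) = cartesianProductWith _∷_ xs (vectorsOver N)

  length-vectorsOver : ∀ N → length (vectorsOver N) ≡ length xs ^ N
  length-vectorsOver zero    = refl
  length-vectorsOver (suc N) =
    trans (length-cartesianProductWith _∷_ xs (vectorsOver N)) (cong (length xs *_) (length-vectorsOver N))

  vectorsOver-unique : Unique xs → ∀ N → Unique (vectorsOver N)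
  vectorsOver-unique xs! zero    = ListAll.[] ∷ []
  vectorsOver-unique xs! (suc N) = cartesianProductWith⁺ _∷_ ∷-injective xs! (vectorsOver-unique xs! N)

  ∈-vectorsOver⇔ : ∀ {N} (v : Vec A N) → v ∈ₗ vectorsOver N ⇔ All (_∈ₗ xs) v
  ∈-vectorsOver⇔ [] = mk⇔ (λ _ → []) (λ _ → here refl)
  ∈-vectorsOver⇔ {suc N} (x ∷ v) = mk⇔ to from
    where
    to : x ∷ v ∈ₗ vectorsOver (suc N) → All (_∈ₗ xs) (x ∷ v)
    to x∷v∈ with ∈-cartesianProductWith⁻ _∷_ xs (vectorsOver N) x∷v∈
    ... | y , w , y∈ , w∈ , refl = y∈ ∷ Equivalence.to (∈-vectorsOver⇔ w) w∈
    from : All (_∈ₗ xs) (x ∷ v) → x ∷ v ∈ₗ vectorsOver (suc N)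
    from (x∈ ∷ v∈) = ∈-cartesianProductWith⁺ _∷_ x∈ (Equivalence.from (∈-vectorsOver⇔ v) v∈)

HasCard-⇔ : ∀ {A : Set} {P Q : A → Set} {k} → (∀ x → P x ⇔ Q x) → HasCard P k → HasCard Q k
HasCard-⇔ P⇔Q = HasCard-image (λ x → x) (λ _ _ e → e) (λ x → Equivalence.to (P⇔Q x))
                              (λ y Qy → y , Equivalence.from (P⇔Q y) Qy , refl)

-- The cyclic lemma and the number of prime parking functions

m+n∸o≤m : ∀ m {n o} → n ≤ o → m + n ∸ o ≤ m
m+n∸o≤m m {n} n≤o = ≤-trans (∸-monoʳ-≤ (m + n) n≤o) (≤-reflexive (m+n∸n≡m m n))

module Rotation (m : ℕ) where

  rotate : ℕ → ℕ → ℕ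
  rotate u x = if x ≤ᵇ u then x + (m ∸ u) else x ∸ u

  unrotate : ℕ → ℕ → ℕ
  unrotate u y = if y + u ≤ᵇ m then y + u else y + u ∸ m

  module _ {u : ℕ} (u<m : u < m) where

    private
      u≤m : u ≤ m
      u≤m = <⇒≤ u<m

    rotate-range : ∀ {x} → InRange m x → InRange m (rotate u x)
    rotate-range {x} (1≤x , x≤m) with x ≤? u
    ... | yes x≤u rewrite ≤ᵇ-true x≤u =
      ≤-trans 1≤x (m≤m+n x _) , ≤-trans (+-monoˡ-≤ (m ∸ u) x≤u) (≤-reflexive (m+[n∸m]≡n u≤m))
    ... | no x≰u  rewrite ≤ᵇ-false (≰⇒> x≰u) = m<n⇒0<n∸m (≰⇒> x≰u) , ≤-trans (m∸n≤m x u) x≤m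

    unrotate-range : ∀ {y} → InRange m y → InRange m (unrotate u y)
    unrotate-range {y} (1≤y , y≤m) with y + u ≤? m
    ... | yes y+u≤m rewrite ≤ᵇ-true y+u≤m = ≤-trans 1≤y (m≤m+n y u) , y+u≤m
    ... | no y+u≰m  rewrite ≤ᵇ-false (≰⇒> y+u≰m) =
      m<n⇒0<n∸m (≰⇒> y+u≰m) , ≤-trans (m≤n+o⇒m∸n≤o (y + u) m (+-monoˡ-≤ u y≤m)) u≤m

    unrotate-rotate : ∀ {x} → InRange m x → unrotate u (rotate u x) ≡ x
    unrotate-rotate {x} (1≤x , x≤m) with x ≤? u
    ... | yes x≤u rewrite ≤ᵇ-true x≤u | +-assoc x (m ∸ u) u | m∸n+n≡m u≤m
                        | ≤ᵇ-false (+-monoˡ-≤ m 1≤x) = m+n∸n≡m x m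
    ... | no x≰u  rewrite ≤ᵇ-false (≰⇒> x≰u) | m∸n+n≡m (<⇒≤ (≰⇒> x≰u)) | ≤ᵇ-true x≤m = refl

    rotate-unrotate : ∀ {y} → InRange m y → rotate u (unrotate u y) ≡ y
    rotate-unrotate {y} (1≤y , y≤m) with y + u ≤? m
    ... | yes y+u≤m rewrite ≤ᵇ-true y+u≤m | ≤ᵇ-false (+-monoˡ-≤ u 1≤y) = m+n∸n≡m y u
    ... | no y+u≰m  rewrite ≤ᵇ-false (≰⇒> y+u≰m)
                          | ≤ᵇ-true (m≤n+o⇒m∸n≤o (y + u) m (+-monoˡ-≤ u y≤m)) = begin
      y + u ∸ m + (m ∸ u)  ≡⟨ +-∸-assoc (y + u ∸ m) u≤m ⟨
      y + u ∸ m + m ∸ u    ≡⟨ cong (_∸ u) (m∸n+n≡m (<⇒≤ (≰⇒> y+u≰m))) ⟩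
      y + u ∸ u            ≡⟨ m+n∸n≡m y u ⟩
      y                    ∎
      where open ≡-Reasoning

    χ-rotate-low : ∀ {j x} → u + j ≤ m → InRange m x →
      χ (rotate u x ≤ᵇ j) + χ (x ≤ᵇ u) ≡ χ (x ≤ᵇ u + j)
    χ-rotate-low {j} {x} u+j≤m (1≤x , _) with x ≤? u
    ... | yes x≤u rewrite ≤ᵇ-true x≤u | ≤ᵇ-true (≤-trans x≤u (m≤m+n u j))
                        | ≤ᵇ-false (≤-trans (s≤s (m+n≤o⇒m≤o∸n j (subst (_≤ m) (+-comm u j) u+j≤m)))
                                            (+-monoˡ-≤ (m ∸ u) 1≤x)) = refl
    ... | no x≰u  rewrite ≤ᵇ-false (≰⇒> x≰u) = trans (+-identityʳ _) (cong χ (∸-≤ᵇ x u j))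

    χ-rotate-wrap : ∀ {j x} → j ≤ m → m ≤ u + j → InRange m x →
      χ (rotate u x ≤ᵇ j) + χ (x ≤ᵇ u) ≡ 1 + χ (x ≤ᵇ u + j ∸ m)
    χ-rotate-wrap {j} {x} j≤m m≤u+j (_ , x≤m) with x ≤? u
    ... | yes x≤u rewrite ≤ᵇ-true x≤u = trans (+-comm _ 1) (cong (λ b → 1 + χ b) (begin
      x + (m ∸ u) ≤ᵇ j                      ≡⟨ cong (x + (m ∸ u) ≤ᵇ_) j≡ ⟨
      x + (m ∸ u) ≤ᵇ (u + j ∸ m) + (m ∸ u)  ≡⟨ ≤ᵇ-+ʳ x (u + j ∸ m) (m ∸ u) ⟩
      x ≤ᵇ u + j ∸ m                        ∎))
      where
      open ≡-Reasoning
      j≡ : u + j ∸ m + (m ∸ u) ≡ j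
      j≡ = begin
        u + j ∸ m + (m ∸ u)   ≡⟨ +-∸-assoc (u + j ∸ m) u≤m ⟨
        u + j ∸ m + m ∸ u     ≡⟨ cong (_∸ u) (m∸n+n≡m m≤u+j) ⟩
        u + j ∸ u             ≡⟨ m+n∸m≡n u j ⟩
        j                     ∎
    ... | no x≰u rewrite ≤ᵇ-false (≰⇒> x≰u)
                       | ≤ᵇ-true (m≤n+o⇒m∸n≤o x u (≤-trans x≤m m≤u+j))
                       | ≤ᵇ-false (≤-<-trans (m+n∸o≤m u j≤m) (≰⇒> x≰u)) = refl

    module _ {N : ℕ} (a : Vec ℕ N) (a-range : ∀ i → InRange m (lookup a i)) where

      countLe-map : ∀ (f : ℕ → ℕ) j → countLe (map f a) j ≡ # (λ i → f (lookup a i) ≤ᵇ j)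
      countLe-map f j =
        trans (countLe-∑ (map f a) j) (sum-cong-≗ λ i → cong (λ y → χ (y ≤ᵇ j)) (lookup-map i f a))

      countLe-rotate-low : ∀ j → u + j ≤ m →
        countLe (map (rotate u) a) j + countLe a u ≡ countLe a (u + j)
      countLe-rotate-low j u+j≤m = begin
        countLe (map (rotate u) a) j + countLe a u
          ≡⟨ cong₂ _+_ (countLe-map (rotate u) j) (countLe-∑ a u) ⟩
        # (λ i → rotate u (lookup a i) ≤ᵇ j) + # (λ i → lookup a i ≤ᵇ u)
          ≡⟨ ∑-distrib-+ (λ i → χ (rotate u (lookup a i) ≤ᵇ j)) (λ i → χ (lookup a i ≤ᵇ u)) ⟨
        ∑ (λ i → χ (rotate u (lookup a i) ≤ᵇ j) + χ (lookup a i ≤ᵇ u))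
          ≡⟨ sum-cong-≗ (λ i → χ-rotate-low u+j≤m (a-range i)) ⟩
        # (λ i → lookup a i ≤ᵇ u + j)
          ≡⟨ countLe-∑ a (u + j) ⟨
        countLe a (u + j) ∎
        where open ≡-Reasoning

      countLe-rotate-wrap : ∀ j → j ≤ m → m ≤ u + j →
        countLe (map (rotate u) a) j + countLe a u ≡ N + countLe a (u + j ∸ m)
      countLe-rotate-wrap j j≤m m≤u+j = begin
        countLe (map (rotate u) a) j + countLe a u
          ≡⟨ cong₂ _+_ (countLe-map (rotate u) j) (countLe-∑ a u) ⟩
        # (λ i → rotate u (lookup a i) ≤ᵇ j) + # (λ i → lookup a i ≤ᵇ u)
          ≡⟨ ∑-distrib-+ (λ i → χ (rotate u (lookup a i) ≤ᵇ j)) (λ i → χ (lookup a i ≤ᵇ u)) ⟨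
        ∑ (λ i → χ (rotate u (lookup a i) ≤ᵇ j) + χ (lookup a i ≤ᵇ u))
          ≡⟨ sum-cong-≗ (λ i → χ-rotate-wrap j≤m m≤u+j (a-range i)) ⟩
        ∑ (λ i → 1 + χ (lookup a i ≤ᵇ u + j ∸ m))
          ≡⟨ ∑-distrib-+ (λ _ → 1) (λ i → χ (lookup a i ≤ᵇ u + j ∸ m)) ⟩
        ∑ (λ (_ : Fin N) → 1) + # (λ i → lookup a i ≤ᵇ u + j ∸ m)
          ≡⟨ cong₂ _+_ (∑-ones N) (sym (countLe-∑ a (u + j ∸ m))) ⟩
        N + countLe a (u + j ∸ m) ∎
        where open ≡-Reasoning

module CyclicLemma (m : ℕ) (a : Vec ℕ (suc m)) where

  open Rotation m

  F : ℕ → ℕ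
  F = countLe a

  -- u ≼ t and u ≺ t compare F u − u with F t − t without truncated subtraction
  _≼_ _≺_ : ℕ → ℕ → Set
  u ≼ t = F u + t ≤ F t + u
  u ≺ t = F u + t < F t + u

  ≼-trans : ∀ {x y z} → x ≼ y → y ≼ z → x ≼ z
  ≼-trans {x} {y} {z} x≼y y≼z = +-cancelˡ-≤ (F y + y) (F x + z) (F z + x) (begin
    F y + y + (F x + z)   ≡⟨ swap₁ (F x) y (F y) z ⟩
    F x + y + (F y + z)   ≤⟨ +-mono-≤ x≼y y≼z ⟩
    F y + x + (F z + y)   ≡⟨ swap₂ (F y) x (F z) y ⟩
    F y + y + (F z + x)   ∎)
    where
    open ≤-Reasoning
    swap₁ : ∀ a y b z → b + y + (a + z) ≡ a + y + (b + z)
    swap₁ = ℕ-Solver.solve-∀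
    swap₂ : ∀ b x c y → b + x + (c + y) ≡ b + y + (c + x)
    swap₂ = ℕ-Solver.solve-∀

  LastMinimumOn : (ℕ → Set) → ℕ → Set
  LastMinimumOn T u = ∀ t → T t → (t ≤ u → u ≼ t) × (u < t → u ≺ t)

  IsLastMinimum : ℕ → Set
  IsLastMinimum = LastMinimumOn (_< m)

  lastMinimum-unique : ∀ {u u′} → u < m → u′ < m → IsLastMinimum u → IsLastMinimum u′ → u ≡ u′
  lastMinimum-unique {u} {u′} u<m u′<m min min′ with <-cmp u u′
  ... | tri≈ _ u≡u′ _ = u≡u′
  ... | tri< u<u′ _ _ = contradiction (proj₁ (min′ u u<m) (<⇒≤ u<u′)) (<⇒≱ (proj₂ (min u′ u′<m) u<u′))
  ... | tri> _ _ u>u′ = contradiction (proj₁ (min u′ u′<m) (<⇒≤ u>u′)) (<⇒≱ (proj₂ (min′ u u<m) u>u′))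

  lastMinimumUpTo : ℕ → ℕ
  lastMinimumUpTo zero    = 0
  lastMinimumUpTo (suc k) = if F (suc k) + b ≤ᵇ F b + suc k then suc k else b
    where b = lastMinimumUpTo k

  lastMinimumUpTo-spec : ∀ k → lastMinimumUpTo k ≤ k × LastMinimumOn (_≤ k) (lastMinimumUpTo k)
  lastMinimumUpTo-spec zero = z≤n , λ { zero z≤n → (λ _ → ≤-refl) , λ () }
  lastMinimumUpTo-spec (suc k) with lastMinimumUpTo k | lastMinimumUpTo-spec k
  ... | b | b≤k , b-min with F (suc k) + b ≤? F b + suc k
  ...   | yes k+1≼b rewrite ≤ᵇ-true k+1≼b =
    ≤-refl , λ t t≤k+1 → (λ _ → new-min t t≤k+1) , λ k+1<t → contradiction t≤k+1 (<⇒≱ k+1<t)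
    where
    new-min : ∀ t → t ≤ suc k → suc k ≼ t
    new-min t t≤k+1 with t ℕ.≟ suc k
    ... | yes refl = ≤-refl
    ... | no t≢k+1 with t ≤? b | b-min t (s≤s⁻¹ (≤∧≢⇒< t≤k+1 t≢k+1))
    ...   | yes t≤b | b≼t , _ = ≼-trans k+1≼b (b≼t t≤b)
    ...   | no t≰b  | _ , b≺t = ≼-trans k+1≼b (<⇒≤ (b≺t (≰⇒> t≰b)))
  ...   | no k+1⋠b rewrite ≤ᵇ-false (≰⇒> k+1⋠b) = ≤-trans b≤k (n≤1+n k) , old-min
    where
    old-min : LastMinimumOn (_≤ suc k) b
    old-min t t≤k+1 with t ℕ.≟ suc k
    ... | yes refl = (λ k+1≤b → contradiction k+1≤b (<⇒≱ (s≤s b≤k))) , λ _ → ≰⇒> k+1⋠b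
    ... | no t≢k+1 = b-min t (s≤s⁻¹ (≤∧≢⇒< t≤k+1 t≢k+1))

  lastMinimum : ℕ
  lastMinimum = lastMinimumUpTo (m ∸ 1)

  lastMinimum-spec : 1 ≤ m → lastMinimum < m × IsLastMinimum lastMinimum
  lastMinimum-spec 1≤m with lastMinimumUpTo-spec (m ∸ 1)
  ... | b≤ , b-min = m≤pred[n]⇒suc[m]≤n {{>-nonZero 1≤m}} b≤ , λ t t<m → b-min t (<⇒≤pred t<m)

  module _ (a-range : ∀ i → InRange m (lookup a i)) where

    F-0 : F 0 ≡ 0
    F-0 = trans (countLe-∑ a 0) (trans (sum-cong-≗ (λ i → cong χ (≤ᵇ-false (proj₁ (a-range i))))) (∑-zeros (suc m)))

    F-m : F m ≡ suc m
    F-m = countLe-all a m (proj₂ ∘ a-range)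

    module _ {u : ℕ} (u<m : u < m) where

      private
        c : ℕ → ℕ
        c = countLe (map (rotate u) a)

      lastMinimum⇒strictlyParks : IsLastMinimum u → StrictlyParks (suc m) (map (rotate u) a)
      lastMinimum⇒strictlyParks min j 1≤j (s≤s j≤m) with u + j ≤? m
      ... | no u+j≰m = +-cancelʳ-≤ (F u) (suc j) (c j) (+-cancelʳ-≤ u (suc j + F u) (c j + F u) (begin
        suc j + F u + u        ≡⟨ shift j (F u) u ⟩
        suc (u + j) + F u      ≡⟨ cong (λ s → suc s + F u) (m∸n+n≡m m≤u+j) ⟨
        suc (t + m) + F u      ≡⟨ regroup t m (F u) ⟩
        suc m + (F u + t)      ≤⟨ +-monoʳ-≤ (suc m) (proj₁ (min t t<m) t≤u) ⟩
        suc m + (F t + u)      ≡⟨ +-assoc (suc m) (F t) u ⟨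
        suc m + F t + u        ≡⟨ cong (_+ u) (countLe-rotate-wrap u<m a a-range j j≤m m≤u+j) ⟨
        c j + F u + u          ∎))
        where
        open ≤-Reasoning
        m≤u+j : m ≤ u + j
        m≤u+j = <⇒≤ (≰⇒> u+j≰m)
        t = u + j ∸ m
        t≤u : t ≤ u
        t≤u = m+n∸o≤m u j≤m
        t<m : t < m
        t<m = ≤-<-trans t≤u u<m
        shift : ∀ j f u → suc j + f + u ≡ suc (u + j) + f
        shift = ℕ-Solver.solve-∀
        regroup : ∀ t m f → suc (t + m) + f ≡ suc m + (f + t)
        regroup = ℕ-Solver.solve-∀
      ... | yes u+j≤m with u + j ℕ.≟ m
      ...   | yes u+j≡m = +-cancelʳ-≤ (F u) (suc j) (c j) (begin
        suc j + F u            ≤⟨ +-monoʳ-≤ (suc j) F-u≤u ⟩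
        suc j + u              ≡⟨ cong suc (trans (+-comm j u) u+j≡m) ⟩
        suc m                  ≡⟨ trans (cong F u+j≡m) F-m ⟨
        F (u + j)              ≡⟨ countLe-rotate-low u<m a a-range j u+j≤m ⟨
        c j + F u              ∎)
        where
        open ≤-Reasoning
        F-u≤u : F u ≤ u
        F-u≤u = subst₂ _≤_ (+-identityʳ (F u)) (cong (_+ u) F-0) (proj₁ (min 0 (≤-<-trans z≤n u<m)) z≤n)
      ...   | no u+j≢m = +-cancelʳ-≤ (F u) (suc j) (c j) (+-cancelʳ-≤ u (suc j + F u) (c j + F u) (begin
        suc j + F u + u        ≡⟨ shift j (F u) u ⟩
        suc (F u + (u + j))    ≤⟨ proj₂ (min (u + j) (≤∧≢⇒< u+j≤m u+j≢m)) (m<m+n u 1≤j) ⟩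
        F (u + j) + u          ≡⟨ cong (_+ u) (countLe-rotate-low u<m a a-range j u+j≤m) ⟨
        c j + F u + u          ∎))
        where
        open ≤-Reasoning
        shift : ∀ j f u → suc j + f + u ≡ suc (f + (u + j))
        shift = ℕ-Solver.solve-∀

      strictlyParks⇒lastMinimum : StrictlyParks (suc m) (map (rotate u) a) → IsLastMinimum u
      strictlyParks⇒lastMinimum parks t t<m = wrapped , low
        where
        open ≤-Reasoning
        wrapped : t ≤ u → u ≼ t
        wrapped t≤u = +-cancelˡ-≤ (suc m) (F u + t) (F t + u) (begin
          suc m + (F u + t)          ≡⟨ cong (λ s → suc s + (F u + t)) e+u≡m ⟨
          suc (e + u) + (F u + t)    ≡⟨ regroup e u t (F u) ⟩
          suc j + F u + u            ≤⟨ +-monoˡ-≤ u (+-monoˡ-≤ (F u) (parks j 1≤j (s≤s j≤m))) ⟩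
          c j + F u + u              ≡⟨ cong (_+ u) (countLe-rotate-wrap u<m a a-range j j≤m m≤u+j) ⟩
          suc m + F (u + j ∸ m) + u  ≡⟨ cong (λ s → suc m + F s + u) u+j∸m≡t ⟩
          suc m + F t + u            ≡⟨ +-assoc (suc m) (F t) u ⟩
          suc m + (F t + u)          ∎)
          where
          e = m ∸ u
          j = e + t
          e+u≡m : e + u ≡ m
          e+u≡m = m∸n+n≡m (<⇒≤ u<m)
          1≤j : 1 ≤ j
          1≤j = ≤-trans (m<n⇒0<n∸m u<m) (m≤m+n e t)
          j≤m : j ≤ m
          j≤m = ≤-trans (+-monoʳ-≤ e t≤u) (≤-reflexive e+u≡m)
          u+j≡m+t : u + j ≡ m + t
          u+j≡m+t = trans (sym (+-assoc u e t)) (cong (_+ t) (trans (+-comm u e) e+u≡m))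
          m≤u+j : m ≤ u + j
          m≤u+j = subst (m ≤_) (sym u+j≡m+t) (m≤m+n m t)
          u+j∸m≡t : u + j ∸ m ≡ t
          u+j∸m≡t = trans (cong (_∸ m) u+j≡m+t) (m+n∸m≡n m t)
          regroup : ∀ e u t f → suc (e + u) + (f + t) ≡ suc (e + t) + f + u
          regroup = ℕ-Solver.solve-∀
        low : u < t → u ≺ t
        low u<t = begin
          suc (F u + t)              ≡⟨ cong (λ s → suc (F u + s)) u+j≡t ⟨
          suc (F u + (u + j))        ≡⟨ shift (F u) u j ⟩
          suc j + F u + u            ≤⟨ +-monoˡ-≤ u (+-monoˡ-≤ (F u) (parks j 1≤j (s≤s j≤m))) ⟩
          c j + F u + u              ≡⟨ cong (_+ u) (countLe-rotate-low u<m a a-range j u+j≤m) ⟩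
          F (u + j) + u              ≡⟨ cong (λ s → F s + u) u+j≡t ⟩
          F t + u                    ∎
          where
          j = t ∸ u
          u+j≡t : u + j ≡ t
          u+j≡t = m+[n∸m]≡n (<⇒≤ u<t)
          u+j≤m : u + j ≤ m
          u+j≤m = subst (_≤ m) (sym u+j≡t) (<⇒≤ t<m)
          1≤j : 1 ≤ j
          1≤j = m<n⇒0<n∸m u<t
          j≤m : j ≤ m
          j≤m = ≤-trans (m∸n≤m t u) (<⇒≤ t<m)
          shift : ∀ f u j → suc (f + (u + j)) ≡ suc j + f + u
          shift = ℕ-Solver.solve-∀

oneTo : ℕ → List ℕ
oneTo m = applyUpTo suc m

∈-oneTo⇔ : ∀ m x → x ∈ₗ oneTo m ⇔ InRange m x
∈-oneTo⇔ m x = mk⇔ to from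
  where
  to : x ∈ₗ oneTo m → InRange m x
  to x∈ with ∈-applyUpTo⁻ suc x∈
  ... | i , i<m , refl = s≤s z≤n , i<m
  from : InRange m x → x ∈ₗ oneTo m
  from (s≤s z≤n , x≤m) = ∈-applyUpTo⁺ suc x≤m

inRange-count : ∀ m N → HasCard (All (InRange m)) (m ^ N)
inRange-count m N =
  vectorsOver (oneTo m) N ,
  vectorsOver-unique (oneTo m) (applyUpTo⁺₁ suc m λ i<j _ → <⇒≢ i<j ∘ suc-injective) N ,
  (λ v → mk⇔ (All.map (Equivalence.to (∈-oneTo⇔ m _)) ∘ Equivalence.to (∈-vectorsOver⇔ (oneTo m) v))
             (Equivalence.from (∈-vectorsOver⇔ (oneTo m) v) ∘ All.map (Equivalence.from (∈-oneTo⇔ m _)))) ,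
  trans (length-vectorsOver (oneTo m) N) (cong (_^ N) (length-applyUpTo suc m))

map-inverseOn : ∀ {A : Set} {P : A → Set} {f g : A → A} → (∀ {x} → P x → g (f x) ≡ x) →
                ∀ {N} {v : Vec A N} → All P v → map g (map f v) ≡ v
map-inverseOn inv []         = refl
map-inverseOn inv (px ∷ pxs) = cong₂ _∷_ (inv px) (map-inverseOn inv pxs)

module PrimeParkingBijection (k : ℕ) where

  m : ℕ
  m = suc k

  open Rotation m
  open CyclicLemma using (IsLastMinimum; lastMinimum; lastMinimum-spec; lastMinimum-unique;
                          lastMinimum⇒strictlyParks; strictlyParks⇒lastMinimum)

  pivot : Vec ℕ m → ℕ
  pivot rest = lastMinimum m (m ∷ rest)

  -- The first entry m records the shift: it becomes m ∸ u, from which u is recovered.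
  toPrimePF : Vec ℕ m → Vec ℕ (suc m)
  toPrimePF rest = map (rotate (pivot rest)) (m ∷ rest)

  lead-range : ∀ rest → All (InRange m) rest → ∀ (i : Fin (suc m)) → InRange m (lookup (m ∷ rest) i)
  lead-range rest rest-range = All.lookup⁺ ((s≤s z≤n , ≤-refl) ∷ rest-range)

  pivot<m : ∀ rest → pivot rest < m
  pivot<m rest = proj₁ (lastMinimum-spec m (m ∷ rest) (s≤s z≤n))

  rotate-m : ∀ {u} → u < m → rotate u m ≡ m ∸ u
  rotate-m {u} u<m rewrite ≤ᵇ-false {m} {u} u<m = refl

  toPrimePF-prime : ∀ rest → All (InRange m) rest → IsPrimePF (suc m) (toPrimePF rest)
  toPrimePF-prime rest rest-range = Equivalence.from (isPrimePF⇔strict (suc m) (toPrimePF rest)) (ranges , strict)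
    where
    u<m : pivot rest < m
    u<m = pivot<m rest
    ranges : ∀ i → InRange (suc m) (lookup (toPrimePF rest) i)
    ranges i rewrite lookup-map i (rotate (pivot rest)) (m ∷ rest) =
      let (1≤y , y≤m) = rotate-range u<m {lookup (m ∷ rest) i} (lead-range rest rest-range i)
      in 1≤y , ≤-trans y≤m (n≤1+n m)
    strict : StrictlyParks (suc m) (toPrimePF rest)
    strict = lastMinimum⇒strictlyParks m (m ∷ rest) (lead-range rest rest-range) {pivot rest} u<m
               (proj₂ (lastMinimum-spec m (m ∷ rest) (s≤s z≤n)))

  toPrimePF-injective : ∀ {r r′} → All (InRange m) r → All (InRange m) r′ →
                        toPrimePF r ≡ toPrimePF r′ → r ≡ r′
  toPrimePF-injective {r} {r′} r-range r′-range e = begin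
    r                                  ≡⟨ map-inverseOn (unrotate-rotate u<m) r-range ⟨
    map (unrotate u) (map (rotate u) r)  ≡⟨ cong (map (unrotate u)) tails ⟩
    map (unrotate u) (map (rotate u) r′) ≡⟨ map-inverseOn (unrotate-rotate u<m) r′-range ⟩
    r′                                 ∎
    where
    open ≡-Reasoning
    u = pivot r
    u<m : u < m
    u<m = pivot<m r
    u′<m : pivot r′ < m
    u′<m = pivot<m r′
    u≡u′ : u ≡ pivot r′
    u≡u′ = begin
      u                  ≡⟨ m∸[m∸n]≡n (<⇒≤ u<m) ⟨
      m ∸ (m ∸ u)        ≡⟨ cong (m ∸_) (trans (sym (rotate-m u<m)) (trans (∷-injectiveˡ e) (rotate-m u′<m))) ⟩
      m ∸ (m ∸ pivot r′) ≡⟨ m∸[m∸n]≡n (<⇒≤ u′<m) ⟩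
      pivot r′           ∎
    tails : map (rotate u) r ≡ map (rotate u) r′
    tails = trans (∷-injectiveʳ e) (cong (λ v → map (rotate v) r′) (sym u≡u′))

  toPrimePF-surjective : ∀ b → IsPrimePF (suc m) b → ∃[ rest ] (All (InRange m) rest × toPrimePF rest ≡ b)
  toPrimePF-surjective (h ∷ bt) prime = rest , rest-range , toPrimePF-rest
    where
    bounds : ∀ i → InRange (suc m) (lookup (h ∷ bt) i)
    bounds = proj₁ (Equivalence.to (isPrimePF⇔strict (suc m) (h ∷ bt)) prime)
    strict : StrictlyParks (suc m) (h ∷ bt)
    strict = proj₂ (Equivalence.to (isPrimePF⇔strict (suc m) (h ∷ bt)) prime)
    b≤m : ∀ i → lookup (h ∷ bt) i ≤ m
    b≤m = countLe≥n⇒≤ (h ∷ bt) m (strict m (s≤s z≤n) ≤-refl)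
    1≤h : 1 ≤ h
    1≤h = proj₁ (bounds zero)
    u = m ∸ h
    u<m : u < m
    u<m = ∸-monoʳ-< {m} {h} {0} 1≤h (b≤m zero)
    bt-range : All (InRange m) bt
    bt-range = All.lookup⁻ λ i → proj₁ (bounds (suc i)) , b≤m (suc i)
    rest = map (unrotate u) bt
    rest-range : All (InRange m) rest
    rest-range = All.map⁺ (All.map (unrotate-range u<m) bt-range)
    rotated : map (rotate u) (m ∷ rest) ≡ h ∷ bt
    rotated = cong₂ _∷_ (trans (rotate-m u<m) (m∸[m∸n]≡n (b≤m zero))) (map-inverseOn (rotate-unrotate u<m) bt-range)
    u-min : IsLastMinimum m (m ∷ rest) u
    u-min = strictlyParks⇒lastMinimum m (m ∷ rest) (lead-range rest rest-range) u<m
              (subst (StrictlyParks (suc m)) (sym rotated) strict)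
    pivot≡u : pivot rest ≡ u
    pivot≡u = lastMinimum-unique m (m ∷ rest) (pivot<m rest) u<m
                (proj₂ (lastMinimum-spec m (m ∷ rest) (s≤s z≤n))) u-min
    toPrimePF-rest : toPrimePF rest ≡ h ∷ bt
    toPrimePF-rest = trans (cong (λ v → map (rotate v) (m ∷ rest)) pivot≡u) rotated

primePF-count : ∀ m → HasCard (IsPrimePF (suc m)) (m ^ m)
primePF-count zero =
  HasCard-image (λ _ → 1 ∷ []) (λ { {[]} {[]} _ _ _ → refl }) (λ _ _ → only-prime) unique (inRange-count 0 0)
  where
  only-prime : IsPrimePF 1 (1 ∷ [])
  only-prime = Equivalence.from (isPrimePF⇔strict 1 (1 ∷ []))
    ((λ { zero → s≤s z≤n , s≤s z≤n }) , λ { j 1≤j (s≤s j≤0) → ⊥-elim (<⇒≱ 1≤j j≤0) })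
  unique : ∀ b → IsPrimePF 1 b → ∃[ v ] (All (InRange 0) v × 1 ∷ [] ≡ b)
  unique (x ∷ []) prime with proj₁ (Equivalence.to (isPrimePF⇔strict 1 (x ∷ [])) prime) zero
  ... | 1≤x , x≤1 = [] , [] , cong (_∷ []) (≤-antisym 1≤x x≤1)
primePF-count (suc k) = HasCard-image toPrimePF toPrimePF-injective toPrimePF-prime toPrimePF-surjective
                                      (inRange-count (suc k) (suc k))
  where open PrimeParkingBijection k

stronglyRecurrent-count : ∀ {n k} → HasCard (IsPrimePF n) k → HasCard (StronglyRecurrent (K0 n)) k
stronglyRecurrent-count {n} = HasCard-image toConfig (λ _ _ → toConfig-injective) isPrimePF⇒stronglyRecurrent
  λ c sr → let c≡ = stable⇒toConfig∘fromConfig c (proj₁ (proj₁ sr)) in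
    fromConfig c ,
    stronglyRecurrent⇒isPrimePF (fromConfig c) (subst (StronglyRecurrent (K0 n)) (sym c≡) sr) ,
    c≡

proposition3p4 : (n : ℕ) → 1 ≤ n →
    (∀ (p : Vec ℕ n) → IsPrimePF n p ⇔ IsPrimeGPF (K0 n) p)
    × HasCard (IsPrimeGPF (K0 n)) ((n ∸ 1) ^ (n ∸ 1))
    × HasCard (StronglyRecurrent (K0 n)) ((n ∸ 1) ^ (n ∸ 1))
proposition3p4 (suc m) _ =
  isPrimePF⇔isPrimeGPF (suc m) ,
  HasCard-⇔ (isPrimePF⇔isPrimeGPF (suc m)) (primePF-count m) ,
  stronglyRecurrent-count (primePF-count m)
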